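{- For all integers $n,k$ with $1\le k\le n-1$, $$I_{n,k}=I_{n,k-1}+C_k\sum_{i=0}^{n-k} I_{i,k-1}\,U_{n-k-i,k}\qquad\text{and}\qquad U_{n,k}=U_{n,k-1}+\sum_{i=0}^{n-k}U_{i,k-1}\,C_k\,U_{n-k-i,k}.$$
   Context: $C_m=\frac{1}{m+1}\binom{2m}{m}$ is the $m$-th Catalan number. Parking rules: $n$ spots $1,\dots,n$; cars $c_1,\dots,c_n$ arrive in order with preferences $a_j\in[n]$; $k$-Naples rule: $c_j$ parks at $a_j$ if empty, otherwise checks spots $a_j-1,\dots,a_j-k$ (those $\ge1$) in order and parks in the first empty one, otherwise drives forward from $a_j$ and parks in the first empty spot after $a_j$ (failing if none). A preference is a $k$-Naples parking function if all cars park; $0$-Naples parking functions are ordinary parking functions. $I_{n,k}$ is the number of ascending (weakly increasing) $k$-Naples parking functions of length $n$, and $U_{n,k}$ is the number of those whose first entry is $1$. Conventions: $I_{n,0}=C_n$ for $n\ge0$ (in particular the empty sequence counts once, so $I_{0,k}=1$), $U_{n,0}=C_n$ for $n\ge1$, and $U_{0,k}=0$ for all $k\ge0$. -}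

module Defs where

open import Data.Nat using (ℕ; zero; suc; _+_; _*_; _∸_; _≤ᵇ_)
open import Data.Bool using (Bool; true; false; if_then_else_; _∧_)
open import Data.List using (List; []; _∷_; length; map; concatMap; filter; sum; upTo)
open import Data.Maybe using (Maybe; just; nothing; _>>=_)
open import Relation.Nullary.Decidable using (Dec; yes; no)
open import Relation.Binary.PropositionalEquality using (_≡_)
open import Data.Bool using (T)
open import Data.Nat.Combinatorics using (_C_)
open import Data.Nat.Base using (_/_)

catalan : ℕ → ℕ
catalan m = ((m + m) C m) / suc m

-- Parking lot state: spots 1..n, represented as a list of Bools
-- (true = occupied); spot i (1-based) is the (i-1)-th element.

-- is spot i (1-based) free?  spots outside 1..length are never free
free : List Bool → ℕ → Bool
free _ zero = false
free [] (suc _) = false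
free (b ∷ bs) (suc zero) = if b then false else true
free (b ∷ bs) (suc (suc i)) = free bs (suc i)

occupy : List Bool → ℕ → List Bool
occupy [] _ = []
occupy (b ∷ bs) zero = b ∷ bs
occupy (b ∷ bs) (suc zero) = true ∷ bs
occupy (b ∷ bs) (suc (suc i)) = b ∷ occupy bs (suc i)

backward : List Bool → ℕ → ℕ → Maybe ℕ
backward s a zero = nothing
backward s zero (suc k) = nothing
backward s (suc zero) (suc k) = nothing
backward s (suc (suc a)) (suc k) =
  if free s (suc a) then just (suc a) else backward s (suc a) k

forward : List Bool → ℕ → ℕ → Maybe ℕ
forward s a zero = nothing
forward s a (suc fuel) =
  if free s (suc a) then just (suc a) else forward s (suc a) fuel

-- the spot car with preference a parks in under the k-Naples rule
-- (nothing = car fails to park)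
parkSpot : ℕ → List Bool → ℕ → Maybe ℕ
parkSpot k s a with free s a
... | true = just a
... | false with backward s a k
...   | just j = just j
...   | nothing = forward s a (length s)

runCars : ℕ → List Bool → List ℕ → Maybe (List Bool)
runCars k s [] = just s
runCars k s (a ∷ as) = parkSpot k s a >>= λ j → runCars k (occupy s j) as

emptyLot : ℕ → List Bool
emptyLot zero = []
emptyLot (suc n) = false ∷ emptyLot n

isJust : {A : Set} → Maybe A → Bool
isJust (just _) = true
isJust nothing = false

prefs : ℕ → ℕ → List (List ℕ)
prefs n zero = [] ∷ []
prefs n (suc m) = concatMap (λ a → map (a ∷_) (prefs n m)) (map suc (upTo n))

ascending : List ℕ → Bool
ascending [] = true
ascending (a ∷ []) = true
ascending (a ∷ b ∷ as) = (a ≤ᵇ b) ∧ ascending (b ∷ as)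

isNaplesPF : ℕ → ℕ → List ℕ → Bool
isNaplesPF n k α = isJust (runCars k (emptyLot n) α)

firstIsOne : List ℕ → Bool
firstIsOne (suc zero ∷ _) = true
firstIsOne _ = false

count : {A : Set} → (A → Bool) → List A → ℕ
count p [] = 0
count p (x ∷ xs) = if p x then suc (count p xs) else count p xs

I : ℕ → ℕ → ℕ
I n k = count (λ α → ascending α ∧ isNaplesPF n k α) (prefs n n)

U : ℕ → ℕ → ℕ
U n k = count (λ α → ascending α ∧ isNaplesPF n k α ∧ firstIsOne α) (prefs n n)

sumTo : ℕ → (ℕ → ℕ) → ℕ
sumTo zero f = f 0
sumTo (suc m) f = sumTo m f + f (suc m)

-- A weakly increasing preference list is recorded by its content vector, the
-- number of cars preferring each spot, and the k-Naples process on it is a finite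
-- automaton scanning the spots from left to right: it tracks either the cars pushed
-- forward or the holes left behind together with the age of the oldest one, and
-- the lot fills iff that age stays below k.  A vector accepted with reach k but not
-- k − 1 first fails for k − 1 when its oldest hole reaches age k − 1.  Cutting there
-- leaves a (k−1)-Naples prefix, a block of k spots in which the hole survives to
-- the limit, and a k-Naples remainder whose first spot is preferred by some car,
-- i.e. one counted by U.  The blocks are ballot paths and there are C_k of them;
-- for U the prefix must in addition start with 1.

module Submission where

open import Defs
open import Data.Nat
open import Data.Nat.Properties
open import Data.Nat.Combinatorics using (_C_; nCk+nC[k+1]≡[n+1]C[k+1]; k>n⇒nCk≡0; nCn≡1; nCk≡nC[n∸k]; nC1≡n)
open import Data.Nat.DivMod using (m*n/n≡m)
open import Data.Nat.Tactic.RingSolver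
open import Algebra.Properties.CommutativeSemigroup +-commutativeSemigroup using () renaming (interchange to +-interchange)
open import Algebra.Properties.CommutativeSemigroup *-commutativeSemigroup using () renaming (x∙yz≈y∙xz to *-left-comm)
open import Data.Bool using (Bool; true; false; if_then_else_; _∧_; not; T)
open import Data.Bool.Properties using (∧-assoc; ∧-comm; ∧-zeroʳ; T-≡)
open import Data.Empty using (⊥-elim)
open import Data.Unit using (⊤)
open import Data.List using (List; []; _∷_; _++_; map; concatMap; length; take; drop; applyUpTo; upTo; replicate; reverse)
open import Data.List.Properties using (length-take; length-drop; length-reverse; unfold-reverse; ++-assoc; length-replicate; length-++; take-[])
open import Data.Nat.ListAction using (sum)
open import Data.Nat.ListAction.Properties using (sum-++)
open import Data.List.Relation.Unary.All using (All; []; _∷_)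
import Data.List.Relation.Unary.All as All
open import Data.List.Relation.Unary.All.Properties using (++⁺; replicate⁺)
open import Data.Maybe using (Maybe; just; nothing)
import Data.Maybe as Maybe
open import Data.Product using (_×_; _,_; Σ; proj₁)
open import Data.Sum using (_⊎_; inj₁; inj₂)
open import Function using (_∘_; Equivalence)
open import Relation.Binary.PropositionalEquality
open ≡-Reasoning

-- Finite sums and counting over boxes

indicator : Bool → ℕ
indicator true = 1
indicator false = 0

sumBy : {A : Set} → (A → ℕ) → List A → ℕ
sumBy f [] = 0
sumBy f (x ∷ xs) = f x + sumBy f xs

sumBy-++ : {A : Set} (f : A → ℕ) (xs ys : List A) → sumBy f (xs ++ ys) ≡ sumBy f xs + sumBy f ys
sumBy-++ f [] ys = refl
sumBy-++ f (x ∷ xs) ys = trans (cong (f x +_) (sumBy-++ f xs ys)) (sym (+-assoc (f x) _ _))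

sumBy-cong : {A : Set} {f g : A → ℕ} (xs : List A) → (∀ x → f x ≡ g x) → sumBy f xs ≡ sumBy g xs
sumBy-cong [] e = refl
sumBy-cong (x ∷ xs) e = cong₂ _+_ (e x) (sumBy-cong xs e)

sumBy-+ : {A : Set} (f g : A → ℕ) (xs : List A) → sumBy (λ x → f x + g x) xs ≡ sumBy f xs + sumBy g xs
sumBy-+ f g [] = refl
sumBy-+ f g (x ∷ xs) = trans (cong (f x + g x +_) (sumBy-+ f g xs)) (+-interchange (f x) (g x) _ _)

sumBy-*ʳ : {A : Set} (f : A → ℕ) (c : ℕ) (xs : List A) → sumBy (λ x → f x * c) xs ≡ sumBy f xs * c
sumBy-*ʳ f c [] = refl
sumBy-*ʳ f c (x ∷ xs) = trans (cong (f x * c +_) (sumBy-*ʳ f c xs)) (sym (*-distribʳ-+ c (f x) (sumBy f xs)))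

sumBy-zero : {A : Set} (f : A → ℕ) (xs : List A) → (∀ x → f x ≡ 0) → sumBy f xs ≡ 0
sumBy-zero f [] e = refl
sumBy-zero f (x ∷ xs) e = cong₂ _+_ (e x) (sumBy-zero f xs e)

count≡sumBy : {A : Set} (p : A → Bool) (xs : List A) → count p xs ≡ sumBy (indicator ∘ p) xs
count≡sumBy p [] = refl
count≡sumBy p (x ∷ xs) with p x
... | true = cong suc (count≡sumBy p xs)
... | false = count≡sumBy p xs

count-cong : {A : Set} {p q : A → Bool} (xs : List A) → (∀ x → p x ≡ q x) → count p xs ≡ count q xs
count-cong {p = p} {q} xs e = begin
  count p xs                ≡⟨ count≡sumBy p xs ⟩
  sumBy (indicator ∘ p) xs  ≡⟨ sumBy-cong xs (cong indicator ∘ e) ⟩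
  sumBy (indicator ∘ q) xs  ≡⟨ count≡sumBy q xs ⟨
  count q xs                ∎

count-none : {A : Set} (p : A → Bool) (xs : List A) → (∀ x → p x ≡ false) → count p xs ≡ 0
count-none p xs e = trans (count≡sumBy p xs) (sumBy-zero _ xs (cong indicator ∘ e))

count-∧ˡ : {A : Set} (b : Bool) (p : A → Bool) (xs : List A) → count (λ x → b ∧ p x) xs ≡ indicator b * count p xs
count-∧ˡ true p xs = sym (+-identityʳ _)
count-∧ˡ false p xs = count-none _ xs (λ _ → refl)

sumBy-count-* : {A : Set} (p : A → Bool) (c : ℕ) (xs : List A) → sumBy (λ x → indicator (p x) * c) xs ≡ count p xs * c
sumBy-count-* p c xs = trans (sumBy-*ʳ (indicator ∘ p) c xs) (cong (_* c) (sym (count≡sumBy p xs)))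

sumBy-sumTo : {A : Set} (m : ℕ) (g : ℕ → A → ℕ) (xs : List A) → sumBy (λ x → sumTo m (λ i → g i x)) xs ≡ sumTo m (λ i → sumBy (g i) xs)
sumBy-sumTo zero g xs = refl
sumBy-sumTo (suc m) g xs = trans (sumBy-+ (λ x → sumTo m (λ i → g i x)) (g (suc m)) xs) (cong (_+ sumBy (g (suc m)) xs) (sumBy-sumTo m g xs))

sumBy-map : {A B : Set} (f : B → ℕ) (g : A → B) (xs : List A) → sumBy f (map g xs) ≡ sumBy (f ∘ g) xs
sumBy-map f g [] = refl
sumBy-map f g (x ∷ xs) = cong (f (g x) +_) (sumBy-map f g xs)

sumBy-concatMap : {A B : Set} (f : B → ℕ) (g : A → List B) (xs : List A) → sumBy f (concatMap g xs) ≡ sumBy (sumBy f ∘ g) xs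
sumBy-concatMap f g [] = refl
sumBy-concatMap f g (x ∷ xs) = trans (sumBy-++ f (g x) (concatMap g xs)) (cong (sumBy f (g x) +_) (sumBy-concatMap f g xs))

count-map : {A B : Set} (p : B → Bool) (g : A → B) (xs : List A) → count p (map g xs) ≡ count (p ∘ g) xs
count-map p g xs = trans (count≡sumBy p (map g xs)) (trans (sumBy-map _ g xs) (sym (count≡sumBy (p ∘ g) xs)))

count-concatMap : {A B : Set} (p : B → Bool) (g : A → List B) (xs : List A) → count p (concatMap g xs) ≡ sumBy (count p ∘ g) xs
count-concatMap p g xs = trans (count≡sumBy p (concatMap g xs)) (trans (sumBy-concatMap _ g xs) (sumBy-cong xs (sym ∘ count≡sumBy p ∘ g)))

sumTo-cong : (m : ℕ) {f g : ℕ → ℕ} → (∀ i → i ≤ m → f i ≡ g i) → sumTo m f ≡ sumTo m g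
sumTo-cong zero e = e 0 z≤n
sumTo-cong (suc m) e = cong₂ _+_ (sumTo-cong m (λ i i≤m → e i (m≤n⇒m≤1+n i≤m))) (e (suc m) ≤-refl)

sumTo-*ˡ : (m c : ℕ) (f : ℕ → ℕ) → sumTo m (λ i → c * f i) ≡ c * sumTo m f
sumTo-*ˡ zero c f = refl
sumTo-*ˡ (suc m) c f = trans (cong (_+ c * f (suc m)) (sumTo-*ˡ m c f)) (sym (*-distribˡ-+ c (sumTo m f) (f (suc m))))

sumTo-zero : (m : ℕ) (f : ℕ → ℕ) → (∀ i → i ≤ m → f i ≡ 0) → sumTo m f ≡ 0
sumTo-zero zero f e = e 0 z≤n
sumTo-zero (suc m) f e = cong₂ _+_ (sumTo-zero m f (λ i i≤m → e i (m≤n⇒m≤1+n i≤m))) (e (suc m) ≤-refl)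

sumTo-uncons : (m : ℕ) (f : ℕ → ℕ) → sumTo (suc m) f ≡ f 0 + sumTo m (f ∘ suc)
sumTo-uncons zero f = refl
sumTo-uncons (suc m) f = trans (cong (_+ f (suc (suc m))) (sumTo-uncons m f)) (+-assoc (f 0) _ _)

sumTo-padZeros : (m M : ℕ) (f : ℕ → ℕ) → m ≤ M → (∀ i → m < i → f i ≡ 0) → sumTo M f ≡ sumTo m f
sumTo-padZeros zero zero f z≤n e = refl
sumTo-padZeros m (suc M) f m≤M e with m≤n⇒m<n∨m≡n m≤M
... | inj₂ refl = refl
... | inj₁ m<M = begin
  sumTo M f + f (suc M)  ≡⟨ cong₂ _+_ (sumTo-padZeros m M f (≤-pred m<M) e) (e (suc M) m<M) ⟩
  sumTo m f + 0          ≡⟨ +-identityʳ _ ⟩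
  sumTo m f              ∎

-- `range M` lists 0, 1, …, M in the order in which `sumTo M` adds them up.
range : ℕ → List ℕ
range zero = 0 ∷ []
range (suc M) = range M ++ (suc M ∷ [])

sumBy-range : (f : ℕ → ℕ) (M : ℕ) → sumBy f (range M) ≡ sumTo M f
sumBy-range f zero = +-identityʳ (f 0)
sumBy-range f (suc M) = begin
  sumBy f (range M ++ suc M ∷ [])          ≡⟨ sumBy-++ f (range M) (suc M ∷ []) ⟩
  sumBy f (range M) + (f (suc M) + 0)      ≡⟨ cong₂ _+_ (sumBy-range f M) (+-identityʳ (f (suc M))) ⟩
  sumTo M f + f (suc M)                    ∎

box : ℕ → ℕ → List (List ℕ)
box zero M = [] ∷ []
box (suc p) M = concatMap (λ c → map (c ∷_) (box p M)) (range M)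

count-box-uncons : (p M : ℕ) (P : List ℕ → Bool) → count P (box (suc p) M) ≡ sumTo M (λ c → count (λ cs → P (c ∷ cs)) (box p M))
count-box-uncons p M P = trans (count-concatMap P _ (range M)) (trans (sumBy-cong (range M) (λ c → count-map P (c ∷_) (box p M))) (sumBy-range _ M))

sumBy-box-cong : ∀ n M (f g : List ℕ → ℕ) → (∀ cs → length cs ≡ n → f cs ≡ g cs) → sumBy f (box n M) ≡ sumBy g (box n M)
sumBy-box-cong zero M f g h = cong (_+ 0) (h [] refl)
sumBy-box-cong (suc n) M f g h =
  trans (sumBy-concatMap f _ (range M))
  (trans (sumBy-cong (range M) (λ c → trans (sumBy-map f (c ∷_) (box n M)) (trans (sumBy-box-cong n M _ _ (λ cs e → h (c ∷ cs) (cong suc e))) (sym (sumBy-map g (c ∷_) (box n M))))))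
  (sym (sumBy-concatMap g _ (range M))))

count-box-cong : ∀ n M (P Q : List ℕ → Bool) → (∀ cs → length cs ≡ n → P cs ≡ Q cs) → count P (box n M) ≡ count Q (box n M)
count-box-cong n M P Q h = trans (count≡sumBy P (box n M)) (trans (sumBy-box-cong n M _ _ (λ cs e → cong indicator (h cs e))) (sym (count≡sumBy Q (box n M))))

count-box-none : ∀ n M (P : List ℕ → Bool) → (∀ cs → length cs ≡ n → P cs ≡ false) → count P (box n M) ≡ 0
count-box-none n M P h = trans (count-box-cong n M P (λ _ → false) h) (count-none (λ _ → false) (box n M) (λ _ → refl))

count-box-+-sumTo : ∀ n M (P Q : List ℕ → Bool) (R : ℕ → List ℕ → Bool) →
  (∀ cs → length cs ≡ n → indicator (P cs) ≡ indicator (Q cs) + sumTo n (λ i → indicator (R i cs))) →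
  count P (box n M) ≡ count Q (box n M) + sumTo n (λ i → count (R i) (box n M))
count-box-+-sumTo n M P Q R pointwise = begin
  count P (box n M)
    ≡⟨ count≡sumBy P (box n M) ⟩
  sumBy (indicator ∘ P) (box n M)
    ≡⟨ sumBy-box-cong n M _ _ pointwise ⟩
  sumBy (λ cs → indicator (Q cs) + sumTo n (λ i → indicator (R i cs))) (box n M)
    ≡⟨ sumBy-+ _ _ (box n M) ⟩
  sumBy (indicator ∘ Q) (box n M) + sumBy (λ cs → sumTo n (λ i → indicator (R i cs))) (box n M)
    ≡⟨ cong₂ _+_ (sym (count≡sumBy Q (box n M))) (sumBy-sumTo n (λ i → indicator ∘ R i) (box n M)) ⟩
  count Q (box n M) + sumTo n (λ i → sumBy (indicator ∘ R i) (box n M))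
    ≡⟨ cong (count Q (box n M) +_) (sumTo-cong n (λ i _ → sym (count≡sumBy (R i) (box n M)))) ⟩
  count Q (box n M) + sumTo n (λ i → count (R i) (box n M)) ∎

count-split : (a b M : ℕ) (F : List ℕ → List ℕ → Bool) →
  count (λ cs → F (take a cs) (drop a cs)) (box (a + b) M) ≡ sumBy (λ x → count (F x) (box b M)) (box a M)
count-split zero b M F = sym (+-identityʳ _)
count-split (suc a) b M F =
  trans (count-concatMap _ _ (range M))
  (trans (sumBy-cong (range M) (λ c → trans (count-map _ (c ∷_) (box (a + b) M)) (count-split a b M (λ x y → F (c ∷ x) y))))
  (trans (sumBy-cong (range M) (λ c → sym (sumBy-map (λ x → count (F x) (box b M)) (c ∷_) (box a M))))
  (sym (sumBy-concatMap _ _ (range M)))))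

count-box-bound : ∀ p M B (P : List ℕ → Bool) → B ≤ M → (∀ xs c ys → length xs + suc (length ys) ≡ p → B < c → P (xs ++ c ∷ ys) ≡ false) → count P (box p M) ≡ count P (box p B)
count-box-bound zero M B P le h = refl
count-box-bound (suc p) M B P le h =
  trans (count-box-uncons p M P)
  (trans (sumTo-cong M (λ c _ → count-box-bound p M B (λ cs → P (c ∷ cs)) le (λ xs c₁ ys e lt → h (c ∷ xs) c₁ ys (cong suc e) lt)))
  (trans (sumTo-padZeros B M _ le (λ c lt → count-box-none p B _ (λ cs e → h [] c cs (cong suc e) lt)))
  (sym (count-box-uncons p B P))))

∈-sum : ∀ xs c ys → c ≤ sum (xs ++ c ∷ ys)
∈-sum xs c ys = ≤-trans (m≤m+n c (sum ys)) (≤-trans (m≤n+m _ (sum xs)) (≤-reflexive (sym (sum-++ xs (c ∷ ys)))))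

-- The automaton

-- Spots are scanned from left to right, c being the number of cars preferring the
-- current spot.  `surplus o`: no spot behind is empty and o cars still look for a
-- spot ahead; `holes a d`: d spots behind are empty, the oldest a + 1 spots back.
-- Later cars fill holes nearest first (`fill`), so under the k-Naples rule every
-- hole can still be filled iff the oldest one is within reach, i.e. a < k.
data State : Set where
  surplus : ℕ → State
  holes : ℕ → ℕ → State

start : State
start = surplus 0

fill : ℕ → ℕ → ℕ → State
fill a zero c = surplus c
fill a (suc d) zero = holes (suc a) (suc d)
fill a (suc d) (suc c) = fill a d c

step : State → ℕ → State
step (surplus zero) zero = holes 0 1
step (surplus zero) (suc c) = surplus c
step (surplus (suc o)) c = surplus (o + c)
step (holes a d) zero = holes (suc a) (suc d)
step (holes a d) (suc c) = fill a d c

reachable : ℕ → State → Bool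
reachable k (surplus _) = true
reachable k (holes a d) = a <ᵇ k

settled : State → Bool
settled (surplus zero) = true
settled (surplus (suc _)) = false
settled (holes _ _) = false

accepts : ℕ → State → List ℕ → Bool
accepts k st [] = settled st
accepts k st (c ∷ cs) = reachable k (step st c) ∧ accepts k (step st c) cs

trace : ℕ → State → List ℕ → Maybe State
trace k st [] = just st
trace k st (c ∷ cs) = if reachable k (step st c) then trace k (step st c) cs else nothing

nothing≢just : {A : Set} {x : A} → nothing ≢ just x
nothing≢just ()

<ᵇ≡true⇒< : ∀ {a k} → (a <ᵇ k) ≡ true → a < k
<ᵇ≡true⇒< {a} {k} e = <ᵇ⇒< a k (Equivalence.from T-≡ e)

<⇒<ᵇ≡true : ∀ {a k} → a < k → (a <ᵇ k) ≡ true
<⇒<ᵇ≡true a<k = Equivalence.to T-≡ (<⇒<ᵇ a<k)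

<ᵇ≡false⇒≥ : ∀ {a k} → (a <ᵇ k) ≡ false → k ≤ a
<ᵇ≡false⇒≥ e = ≮⇒≥ (λ a<k → subst T e (<⇒<ᵇ a<k))

∧≡true⇒right : ∀ a b → a ∧ b ≡ true → b ≡ true
∧≡true⇒right true b e = e

reachable-suc : ∀ k st → reachable k st ≡ true → reachable (suc k) st ≡ true
reachable-suc k (surplus x) e = refl
reachable-suc k (holes a d) e = <⇒<ᵇ≡true {a} {suc k} (m<n⇒m<1+n (<ᵇ≡true⇒< {a} {k} e))

trace-tail : ∀ k st c b s → trace k st (c ∷ b) ≡ just s → trace k (step st c) b ≡ just s
trace-tail k st c b s e with reachable k (step st c)
... | true = e
... | false = ⊥-elim (nothing≢just e)

trace-reachable-head : ∀ k st c b s → trace k st (c ∷ b) ≡ just s → reachable k (step st c) ≡ true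
trace-reachable-head k st c b s e with reachable k (step st c)
... | true = refl
... | false = ⊥-elim (nothing≢just e)

trace-reachable : ∀ k st b s → trace k st b ≡ just s → reachable k st ≡ true → reachable k s ≡ true
trace-reachable k st [] s refl o = o
trace-reachable k st (c ∷ b) s e o = trace-reachable k (step st c) b s (trace-tail k st c b s e) (trace-reachable-head k st c b s e)

mutual
  age<length-surplus : ∀ k o b a d → trace k (surplus o) b ≡ just (holes a d) → a < length b
  age<length-surplus k o [] a d ()
  age<length-surplus k zero (zero ∷ b) a d e = s≤s (age≤length-holes k 0 1 b a d (trace-tail k (surplus 0) 0 b _ e))
  age<length-surplus k zero (suc c ∷ b) a d e = m<n⇒m<1+n (age<length-surplus k c b a d (trace-tail k (surplus 0) (suc c) b _ e))
  age<length-surplus k (suc o) (c ∷ b) a d e = m<n⇒m<1+n (age<length-surplus k (o + c) b a d (trace-tail k (surplus (suc o)) c b _ e))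

  age≤length-holes : ∀ k a₀ d₀ b a d → trace k (holes a₀ d₀) b ≡ just (holes a d) → a ≤ a₀ + length b
  age≤length-holes k a₀ d₀ [] a d refl = ≤-reflexive (sym (+-identityʳ a))
  age≤length-holes k a₀ d₀ (zero ∷ b) a d e = ≤-trans (age≤length-holes k (suc a₀) (suc d₀) b a d (trace-tail k (holes a₀ d₀) 0 b _ e)) (≤-reflexive (sym (+-suc a₀ (length b))))
  age≤length-holes k a₀ d₀ (suc c ∷ b) a d e = age≤length-fill k a₀ d₀ c b a d (trace-tail k (holes a₀ d₀) (suc c) b _ e)

  age≤length-fill : ∀ k a₀ d₀ c b a d → trace k (fill a₀ d₀ c) b ≡ just (holes a d) → a ≤ a₀ + suc (length b)
  age≤length-fill k a₀ zero c b a d e = ≤-trans (<⇒≤ (age<length-surplus k c b a d e)) (≤-trans (n≤1+n _) (m≤n+m _ a₀))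
  age≤length-fill k a₀ (suc d₀) zero b a d e = ≤-trans (age≤length-holes k (suc a₀) (suc d₀) b a d e) (≤-reflexive (sym (+-suc a₀ (length b))))
  age≤length-fill k a₀ (suc d₀) (suc c) b a d e = age≤length-fill k a₀ d₀ c b a d e

WellFormed : State → Set
WellFormed (surplus _) = ⊤
WellFormed (holes a d) = (d ≤ suc a) × (1 ≤ d)

fill-holes : ∀ a d c a₁ d₁ → fill a d c ≡ holes a₁ d₁ → (a₁ ≡ suc a) × (d₁ ≤ d) × (1 ≤ d₁)
fill-holes a zero c a₁ d₁ ()
fill-holes a (suc d) zero .(suc a) .(suc d) refl = refl , ≤-refl , s≤s z≤n
fill-holes a (suc d) (suc c) a₁ d₁ e with fill-holes a d c a₁ d₁ e
... | (p , q , r) = p , m≤n⇒m≤1+n q , r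

step-wellFormed : ∀ st c → WellFormed st → WellFormed (step st c)
step-wellFormed (surplus zero) zero i = s≤s z≤n , s≤s z≤n
step-wellFormed (surplus zero) (suc c) i = _
step-wellFormed (surplus (suc o)) c i = _
step-wellFormed (holes a d) zero (p , q) = s≤s p , s≤s z≤n
step-wellFormed (holes a d) (suc c) (p , q) with fill a d c in eq
... | surplus x = _
... | holes a₁ d₁ with fill-holes a d c a₁ d₁ eq
... | (refl , r , s) = ≤-trans r (m≤n⇒m≤1+n p) , s

trace-wellFormed : ∀ k st b s → trace k st b ≡ just s → WellFormed st → WellFormed s
trace-wellFormed k st [] s refl i = i
trace-wellFormed k st (c ∷ b) s e i = trace-wellFormed k (step st c) b s (trace-tail k st c b s e) (step-wellFormed st c i)

Balance : State → List ℕ → Set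
Balance (surplus o) cs = o + sum cs ≡ length cs
Balance (holes a d) cs = sum cs ≡ length cs + d

fill-balance : ∀ a d c cs → Balance (fill a d c) cs → suc c + sum cs ≡ suc (length cs) + d
fill-balance a zero c cs h = trans (cong suc h) (cong suc (sym (+-identityʳ _)))
fill-balance a (suc d) zero cs h = cong suc h
fill-balance a (suc d) (suc c) cs h = trans (cong suc (fill-balance a d c cs h)) (sym (cong suc (+-suc (length cs) d)))

step-balance : ∀ st c cs → Balance (step st c) cs → Balance st (c ∷ cs)
step-balance (surplus zero) zero cs h = trans h (+-comm (length cs) 1)
step-balance (surplus zero) (suc c) cs h = cong suc h
step-balance (surplus (suc o)) c cs h = cong suc (trans (sym (+-assoc o c (sum cs))) h)
step-balance (holes a d) zero cs h = trans h (+-suc (length cs) d)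
step-balance (holes a d) (suc c) cs h = fill-balance a d c cs h

accepts-balance : ∀ k st cs → accepts k st cs ≡ true → Balance st cs
accepts-balance k (surplus zero) [] e = refl
accepts-balance k (surplus (suc o)) [] ()
accepts-balance k (holes a d) [] ()
accepts-balance k st (c ∷ cs) e = step-balance st c cs (accepts-balance k (step st c) cs (∧≡true⇒right (reachable k (step st c)) _ e))

fill-shape : ∀ a d c → (Σ ℕ λ o → fill a d c ≡ surplus o) ⊎ (Σ ℕ λ d₁ → fill a d c ≡ holes (suc a) d₁)
fill-shape a zero c = inj₁ (c , refl)
fill-shape a (suc d) zero = inj₂ (suc d , refl)
fill-shape a (suc d) (suc c) = fill-shape a d c

step-holes-shape : ∀ a d c → (Σ ℕ λ o → step (holes a d) c ≡ surplus o) ⊎ (Σ ℕ λ d₁ → step (holes a d) c ≡ holes (suc a) d₁)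
step-holes-shape a d zero = inj₂ (suc d , refl)
step-holes-shape a d (suc c) = fill-shape a d c

-- Parking lots around the current spot

-- `lot R o r` is the lot while the spot after those in R is processed: R lists
-- the spots behind, nearest first (true = occupied); ahead, o spots are already
-- taken and r are empty.  `backwardHole R k` is where a backward search of length
-- k from the current spot parks, and `oldestHole R` is the age of the farthest
-- empty spot behind.
ahead : ℕ → ℕ → List Bool
ahead o r = replicate o true ++ replicate r false

lot : List Bool → ℕ → ℕ → List Bool
lot R o r = reverse R ++ ahead o r

backwardHole : List Bool → ℕ → Maybe ℕ
backwardHole [] k = nothing
backwardHole (b ∷ R) zero = nothing
backwardHole (b ∷ R) (suc k) = if b then backwardHole R k else just (suc (length R))

fillNearestHole : List Bool → List Bool
fillNearestHole [] = []
fillNearestHole (true ∷ R) = true ∷ fillNearestHole R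
fillNearestHole (false ∷ R) = true ∷ R

holeCount : List Bool → ℕ
holeCount [] = 0
holeCount (true ∷ R) = holeCount R
holeCount (false ∷ R) = suc (holeCount R)

carCount : List Bool → ℕ
carCount [] = 0
carCount (true ∷ R) = suc (carCount R)
carCount (false ∷ R) = carCount R

lastHoleStep : Bool → Maybe ℕ → Maybe ℕ
lastHoleStep b (just i) = just (suc i)
lastHoleStep true nothing = nothing
lastHoleStep false nothing = just 0

oldestHole : List Bool → Maybe ℕ
oldestHole [] = nothing
oldestHole (b ∷ R) = lastHoleStep b (oldestHole R)

reverse-∷-++ : ∀ (b : Bool) R F → reverse (b ∷ R) ++ F ≡ reverse R ++ (b ∷ F)
reverse-∷-++ b R F = trans (cong (_++ F) (unfold-reverse b R)) (++-assoc (reverse R) (b ∷ []) F)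

free-++ : ∀ xs Z p → free (xs ++ Z) (length xs + suc p) ≡ free Z (suc p)
free-++ [] Z p = refl
free-++ (x ∷ xs) Z p rewrite +-suc (length xs) p = trans (sym (cong (free (xs ++ Z)) (+-suc (length xs) p))) (free-++ xs Z p)

occupy-++ : ∀ xs Z p → occupy (xs ++ Z) (length xs + suc p) ≡ xs ++ occupy Z (suc p)
occupy-++ [] Z p = refl
occupy-++ (x ∷ xs) Z p rewrite +-suc (length xs) p = cong (x ∷_) (trans (sym (cong (occupy (xs ++ Z)) (+-suc (length xs) p))) (occupy-++ xs Z p))

forward-++ : ∀ xs Z a f → forward (xs ++ Z) (length xs + a) f ≡ Maybe.map (length xs +_) (forward Z a f)
forward-++ xs Z a zero = refl
forward-++ xs Z a (suc f) rewrite sym (+-suc (length xs) a) | free-++ xs Z a with free Z (suc a)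
... | true = refl
... | false = forward-++ xs Z (suc a) f

length-reverse-+ : ∀ (R : List Bool) p → length (reverse R) + p ≡ length R + p
length-reverse-+ R p = cong (_+ p) (length-reverse R)

free-reverse-++ : ∀ R Z p → free (reverse R ++ Z) (length R + suc p) ≡ free Z (suc p)
free-reverse-++ R Z p = trans (cong (free (reverse R ++ Z)) (sym (length-reverse-+ R (suc p)))) (free-++ (reverse R) Z p)

occupy-reverse-++ : ∀ R Z p → occupy (reverse R ++ Z) (length R + suc p) ≡ reverse R ++ occupy Z (suc p)
occupy-reverse-++ R Z p = trans (cong (occupy (reverse R ++ Z)) (sym (length-reverse-+ R (suc p)))) (occupy-++ (reverse R) Z p)

forward-reverse-++ : ∀ R Z a f → forward (reverse R ++ Z) (length R + a) f ≡ Maybe.map (length R +_) (forward Z a f)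
forward-reverse-++ R Z a f = trans (cong (λ t → forward (reverse R ++ Z) t f) (sym (length-reverse-+ R a))) (trans (forward-++ (reverse R) Z a f) (cong (λ n → Maybe.map (n +_) (forward Z a f)) (length-reverse R)))

free-current : ∀ R b F → free (reverse R ++ (b ∷ F)) (suc (length R)) ≡ free (b ∷ F) 1
free-current R b F = trans (cong (free (reverse R ++ (b ∷ F))) (+-comm 1 (length R))) (free-reverse-++ R (b ∷ F) 0)

occupy-current : ∀ R F → occupy (reverse R ++ F) (suc (length R)) ≡ reverse R ++ occupy F 1
occupy-current R F = trans (cong (occupy (reverse R ++ F)) (+-comm 1 (length R))) (occupy-reverse-++ R F 0)

backward-lot : ∀ R F k → backward (reverse R ++ F) (suc (length R)) k ≡ backwardHole R k
backward-lot [] F zero = refl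
backward-lot [] F (suc k) = refl
backward-lot (b ∷ R) F zero = refl
backward-lot (b ∷ R) F (suc k) rewrite reverse-∷-++ b R F | free-current R b F | backward-lot R (b ∷ F) k = holeOrNot b
  where
  holeOrNot : ∀ b → (if free (b ∷ F) 1 then just (suc (length R)) else backwardHole R k) ≡ (if b then backwardHole R k else just (suc (length R)))
  holeOrNot true = refl
  holeOrNot false = refl

occupy-backwardHole : ∀ R F k p → backwardHole R k ≡ just p → occupy (reverse R ++ F) p ≡ reverse (fillNearestHole R) ++ F
occupy-backwardHole [] F k p ()
occupy-backwardHole (b ∷ R) F zero p ()
occupy-backwardHole (false ∷ R) F (suc k) .(suc (length R)) refl rewrite reverse-∷-++ false R F | reverse-∷-++ true R F | occupy-current R (false ∷ F) = refl
occupy-backwardHole (true ∷ R) F (suc k) p e rewrite reverse-∷-++ true R F | reverse-∷-++ true (fillNearestHole R) F = occupy-backwardHole R (true ∷ F) k p e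

backwardHole-none : ∀ R k → holeCount R ≡ 0 → backwardHole R k ≡ nothing
backwardHole-none [] k e = refl
backwardHole-none (true ∷ R) zero e = refl
backwardHole-none (true ∷ R) (suc k) e = backwardHole-none R k e
backwardHole-none (false ∷ R) k ()

backwardHole-some : ∀ R k a → oldestHole R ≡ just a → a < k → Σ ℕ λ p → backwardHole R k ≡ just p
backwardHole-some [] k a () lt
backwardHole-some (b ∷ R) zero a e ()
backwardHole-some (false ∷ R) (suc k) a e lt = suc (length R) , refl
backwardHole-some (true ∷ R) (suc k) a e lt with oldestHole R in eq
backwardHole-some (true ∷ R) (suc k) .(suc i) refl lt | just i = backwardHole-some R k i eq (≤-pred lt)

holeCount-fill : ∀ R → holeCount (fillNearestHole R) ≡ pred (holeCount R)
holeCount-fill [] = refl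
holeCount-fill (true ∷ R) = holeCount-fill R
holeCount-fill (false ∷ R) = refl

oldestHole-some : ∀ R → 1 ≤ holeCount R → Σ ℕ λ i → oldestHole R ≡ just i
oldestHole-some [] ()
oldestHole-some (true ∷ R) le with oldestHole-some R le
... | (i , e) rewrite e = suc i , refl
oldestHole-some (false ∷ R) le with oldestHole R
... | just i = suc i , refl
... | nothing = 0 , refl

oldestHole-none : ∀ R → holeCount R ≡ 0 → oldestHole R ≡ nothing
oldestHole-none [] e = refl
oldestHole-none (true ∷ R) e rewrite oldestHole-none R e = refl
oldestHole-none (false ∷ R) ()

oldestHole-fill : ∀ R → 2 ≤ holeCount R → oldestHole (fillNearestHole R) ≡ oldestHole R
oldestHole-fill [] ()
oldestHole-fill (true ∷ R) le = cong (lastHoleStep true) (oldestHole-fill R le)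
oldestHole-fill (false ∷ R) (s≤s le) with oldestHole-some R le
... | (i , e) rewrite e = refl

length-fill : ∀ R → length (fillNearestHole R) ≡ length R
length-fill [] = refl
length-fill (true ∷ R) = cong suc (length-fill R)
length-fill (false ∷ R) = refl

carCount+holeCount : ∀ R → carCount R + holeCount R ≡ length R
carCount+holeCount [] = refl
carCount+holeCount (true ∷ R) = cong suc (carCount+holeCount R)
carCount+holeCount (false ∷ R) = trans (+-suc (carCount R) (holeCount R)) (cong suc (carCount+holeCount R))

oldestHole-free : ∀ R F a → oldestHole R ≡ just a → (a < length R) × (free (reverse R ++ F) (length R ∸ a) ≡ true)
oldestHole-free [] F a ()
oldestHole-free (b ∷ R) F a e with oldestHole R in eq
oldestHole-free (b ∷ R) F .(suc i) refl | just i with oldestHole-free R (b ∷ F) i eq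
... | (lt , fr) rewrite reverse-∷-++ b R F = s≤s lt , fr
oldestHole-free (false ∷ R) F .0 refl | nothing rewrite reverse-∷-++ false R F = s≤s z≤n , free-current R false F

free-replicate-occupied : ∀ m Z p → p < m → free (replicate m true ++ Z) (suc p) ≡ false
free-replicate-occupied (suc m) Z zero lt = refl
free-replicate-occupied (suc m) Z (suc p) (s≤s lt) = free-replicate-occupied m Z p lt

free-replicate-after : ∀ m Z → free (replicate m true ++ Z) (suc m) ≡ free Z 1
free-replicate-after zero Z = refl
free-replicate-after (suc m) Z = free-replicate-after m Z

forward-replicate : ∀ m rest f a → a ≤ m → m < a + f → forward (replicate m true ++ (false ∷ rest)) a f ≡ just (suc m)
forward-replicate m rest zero a le lt = ⊥-elim (<⇒≱ lt (≤-trans (≤-reflexive (+-identityʳ a)) le))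
forward-replicate m rest (suc f) a le lt with m≤n⇒m<n∨m≡n le
... | inj₁ a<m rewrite free-replicate-occupied m (false ∷ rest) a a<m = forward-replicate m rest f (suc a) a<m (≤-trans lt (≤-reflexive (+-suc a f)))
... | inj₂ refl rewrite free-replicate-after a (false ∷ rest) = refl

occupy-replicate : ∀ m rest → occupy (replicate m true ++ (false ∷ rest)) (suc m) ≡ replicate (suc m) true ++ rest
occupy-replicate zero rest = refl
occupy-replicate (suc m) rest = cong (true ∷_) (occupy-replicate m rest)

parkSpot-free : ∀ k s a → free s a ≡ true → parkSpot k s a ≡ just a
parkSpot-free k s a e rewrite e = refl

parkSpot-backward : ∀ k s a p → free s a ≡ false → backward s a k ≡ just p → parkSpot k s a ≡ just p
parkSpot-backward k s a p e b rewrite e | b = refl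

parkSpot-forward : ∀ k s a → free s a ≡ false → backward s a k ≡ nothing → parkSpot k s a ≡ forward s a (length s)
parkSpot-forward k s a e b rewrite e | b = refl

backward-free : ∀ s a k x → backward s a k ≡ just x → free s x ≡ true
backward-free s a zero x ()
backward-free s zero (suc k) x ()
backward-free s (suc zero) (suc k) x ()
backward-free s (suc (suc a)) (suc k) x e with free s (suc a) in eq
... | true with e
...   | refl = eq
backward-free s (suc (suc a)) (suc k) x e | false = backward-free s (suc a) k x e

forward-free : ∀ s a f x → forward s a f ≡ just x → free s x ≡ true
forward-free s a zero x ()
forward-free s a (suc f) x e with free s (suc a) in eq
... | true with e
...   | refl = eq
forward-free s a (suc f) x e | false = forward-free s (suc a) f x e

backward-within : ∀ s a k x → backward s a k ≡ just x → a ≤ x + k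
backward-within s a zero x ()
backward-within s zero (suc k) x ()
backward-within s (suc zero) (suc k) x ()
backward-within s (suc (suc a)) (suc k) x e with free s (suc a)
... | true with e
...   | refl = ≤-trans (s≤s (m≤m+n (suc a) k)) (≤-reflexive (sym (+-suc (suc a) k)))
backward-within s (suc (suc a)) (suc k) x e | false = ≤-trans (s≤s (backward-within s (suc a) k x e)) (≤-reflexive (sym (+-suc x k)))

forward-after : ∀ s a f x → forward s a f ≡ just x → a < x
forward-after s a zero x ()
forward-after s a (suc f) x e with free s (suc a)
... | true with e
...   | refl = ≤-refl
forward-after s a (suc f) x e | false = <-trans (n<1+n a) (forward-after s (suc a) f x e)

parkSpot-sound : ∀ k s a x → parkSpot k s a ≡ just x → (free s x ≡ true) × (a ≤ x + k)
parkSpot-sound k s a x e with free s a in eq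
... | true with e
...   | refl = eq , m≤m+n a k
parkSpot-sound k s a x e | false with backward s a k in eb
... | just j with e
...   | refl = backward-free s a k j eb , backward-within s a k j eb
parkSpot-sound k s a x e | false | nothing = forward-free s a (length s) x e , ≤-trans (<⇒≤ (forward-after s a (length s) x e)) (m≤m+n x k)

occupy-free : ∀ s x → free s x ≡ true → (carCount (occupy s x) ≡ suc (carCount s)) × (length (occupy s x) ≡ length s)
occupy-free [] zero ()
occupy-free [] (suc x) ()
occupy-free (b ∷ s) zero ()
occupy-free (true ∷ s) (suc zero) ()
occupy-free (false ∷ s) (suc zero) e = refl , refl
occupy-free (true ∷ s) (suc (suc x)) e with occupy-free s (suc x) e
... | (p , q) = cong suc p , cong suc q
occupy-free (false ∷ s) (suc (suc x)) e with occupy-free s (suc x) e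
... | (p , q) = p , cong suc q

occupy-other : ∀ s x p → free s p ≡ true → x ≢ p → free (occupy s x) p ≡ true
occupy-other [] x p e ne = e
occupy-other (b ∷ s) zero p e ne = e
occupy-other (b ∷ s) (suc zero) zero () ne
occupy-other (b ∷ s) (suc zero) (suc zero) e ne = ⊥-elim (ne refl)
occupy-other (b ∷ s) (suc zero) (suc (suc p)) e ne = e
occupy-other (b ∷ s) (suc (suc x)) zero () ne
occupy-other (b ∷ s) (suc (suc x)) (suc zero) e ne = e
occupy-other (b ∷ s) (suc (suc x)) (suc (suc p)) e ne = occupy-other s (suc x) (suc p) e (λ q → ne (cong suc q))

free⇒holeCount : ∀ s p → free s p ≡ true → 1 ≤ holeCount s
free⇒holeCount [] zero ()
free⇒holeCount [] (suc p) ()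
free⇒holeCount (b ∷ s) zero ()
free⇒holeCount (true ∷ s) (suc zero) ()
free⇒holeCount (false ∷ s) (suc zero) e = s≤s z≤n
free⇒holeCount (true ∷ s) (suc (suc p)) e = free⇒holeCount s (suc p) e
free⇒holeCount (false ∷ s) (suc (suc p)) e = s≤s z≤n

runCars-stuck : ∀ k s α p → free s p ≡ true → All (λ a → p + k < a) α → carCount s + length α ≡ length s → runCars k s α ≡ nothing
runCars-stuck k s [] p fr [] e = ⊥-elim (<⇒≢ lt (trans (sym (+-identityʳ (carCount s))) e))
  where
  lt : carCount s < length s
  lt = ≤-trans (≤-trans (≤-reflexive (sym (+-comm (carCount s) 1))) (+-monoʳ-≤ (carCount s) (free⇒holeCount s p fr))) (≤-reflexive (carCount+holeCount s))
runCars-stuck k s (a ∷ α) p fr (h ∷ hs) e with parkSpot k s a in eq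
... | nothing = refl
... | just x with parkSpot-sound k s a x eq
...   | (fx , le) with occupy-free s x fx
...     | (cars , len) = runCars-stuck k (occupy s x) α p (occupy-other s x p fr ne) hs (trans (cong (_+ length α) cars) (trans (sym (+-suc (carCount s) (length α))) (trans e (sym len))))
  where
  ne : x ≢ p
  ne refl = <⇒≱ h le

length-lot : ∀ R o r → length (lot R o r) ≡ length R + (o + r)
length-lot R o r = trans (length-++ (reverse R)) (cong₂ _+_ (length-reverse R) (trans (length-++ (replicate o true)) (cong₂ _+_ (length-replicate o) (length-replicate r))))

park-current-free : ∀ k R r rest → runCars k (lot R 0 (suc r)) (suc (length R) ∷ rest) ≡ runCars k (lot R 1 r) rest
park-current-free k R r rest rewrite parkSpot-free k (lot R 0 (suc r)) (suc (length R)) (free-current R false (replicate r false)) | occupy-current R (false ∷ replicate r false) = refl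

lot-long : ∀ R o r → suc o < 1 + length (lot R (suc o) (suc r))
lot-long R o r = s≤s (≤-trans (≤-trans (m≤m+n (suc o) (suc r)) (m≤n+m _ (length R))) (≤-reflexive (sym (length-lot R (suc o) (suc r)))))

park-current-forward : ∀ k R o r rest → holeCount R ≡ 0 → runCars k (lot R (suc o) (suc r)) (suc (length R) ∷ rest) ≡ runCars k (lot R (suc (suc o)) r) rest
park-current-forward k R o r rest n0
  rewrite parkSpot-forward k (lot R (suc o) (suc r)) (suc (length R)) (free-current R true (ahead o (suc r))) (trans (backward-lot R _ k) (backwardHole-none R k n0))
        | trans (cong (λ t → forward (lot R (suc o) (suc r)) t (length (lot R (suc o) (suc r)))) (+-comm 1 (length R))) (forward-reverse-++ R (ahead (suc o) (suc r)) 1 (length (lot R (suc o) (suc r))))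
        | forward-replicate (suc o) (replicate r false) (length (lot R (suc o) (suc r))) 1 (s≤s z≤n) (lot-long R o r)
        | occupy-reverse-++ R (ahead (suc o) (suc r)) (suc o)
        | occupy-replicate (suc o) (replicate r false) = refl

park-current-backward : ∀ k R r p rest → backwardHole R k ≡ just p → runCars k (lot R 1 r) (suc (length R) ∷ rest) ≡ runCars k (lot (fillNearestHole R) 1 r) rest
park-current-backward k R r p rest e rewrite parkSpot-backward k (lot R 1 r) (suc (length R)) p (free-current R true (ahead 0 r)) (trans (backward-lot R _ k) e) | occupy-backwardHole R (ahead 1 r) k p e = refl

park-forward-all : ∀ k R o r c rest → holeCount R ≡ 0 → c ≤ r → runCars k (lot R (suc o) r) (replicate c (suc (length R)) ++ rest) ≡ runCars k (lot R (suc o + c) (r ∸ c)) rest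
park-forward-all k R o r zero rest n0 le rewrite +-identityʳ o = refl
park-forward-all k R o (suc r) (suc c) rest n0 (s≤s le) rewrite park-current-forward k R o r (replicate c (suc (length R)) ++ rest) n0 | park-forward-all k R (suc o) r c rest n0 le | +-suc o c = refl

advance-occupied : ∀ R o r → lot R (suc o) r ≡ lot (true ∷ R) o r
advance-occupied R o r = sym (reverse-∷-++ true R (ahead o r))

advance-hole : ∀ R r → lot R 0 (suc r) ≡ lot (false ∷ R) 0 r
advance-hole R r = sym (reverse-∷-++ false R (replicate r false))

-- The automaton simulates k-Naples parking

-- `expand lo cs` is the weakly increasing preference list with content vector cs,
-- its entries starting at spot lo.
expand : ℕ → List ℕ → List ℕ
expand lo [] = []
expand lo (c ∷ cs) = replicate c lo ++ expand (suc lo) cs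

Represents : State → List Bool → ℕ → Set
Represents (surplus o₁) R o = (o ≡ o₁) × (holeCount R ≡ 0)
Represents (holes a d) R o = (o ≡ 0) × (holeCount R ≡ d) × (oldestHole R ≡ just a)

deficit : State → ℕ
deficit (surplus _) = 0
deficit (holes _ d) = d

-- Parking the cars that prefer the current spot takes a lot representing st to a
-- lot representing step st c; m counts the spots after the current one and S the
-- cars still to come.
record Simulation (k : ℕ) (s : List Bool) (cars rest : List ℕ) (st₂ : State) (len₂ m S : ℕ) : Set where
  field
    behind : List Bool
    occupied : ℕ
    vacant : ℕ
    runCars-eq : runCars k s (cars ++ rest) ≡ runCars k (lot behind occupied vacant) rest
    length-behind : length behind ≡ len₂
    represents : Represents st₂ behind occupied
    ahead+free : occupied + vacant ≡ m
    remaining : S ≡ vacant + deficit st₂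

open Simulation

oldestHole⇒holeCount : ∀ R a → oldestHole R ≡ just a → 1 ≤ holeCount R
oldestHole⇒holeCount R a e with holeCount R in eq
... | zero = ⊥-elim (nothing≢just (trans (sym (oldestHole-none R eq)) e))
... | suc _ = s≤s z≤n

simulate-fill : ∀ k a d c₁ R m S rest → holeCount R ≡ d → (∀ d₁ → d ≡ suc d₁ → oldestHole R ≡ just a) → a < k → c₁ + S ≡ m + d →
  Simulation k (lot R 1 m) (replicate c₁ (suc (length R))) rest (fill a d c₁) (suc (length R)) m S
simulate-fill k a zero c₁ R m S rest n0 lf ak sm = record
  { behind = true ∷ R ; occupied = c₁ ; vacant = m ∸ c₁
  ; runCars-eq = trans (park-forward-all k R 0 m c₁ rest n0 c≤) (cong (λ s → runCars k s rest) (advance-occupied R c₁ (m ∸ c₁)))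
  ; length-behind = refl ; represents = refl , n0 ; ahead+free = m+[n∸m]≡n c≤
  ; remaining = trans (sym (m+n∸m≡n c₁ S)) (trans (cong (_∸ c₁) (trans sm (+-identityʳ m))) (sym (+-identityʳ _))) }
  where
  c≤ : c₁ ≤ m
  c≤ = ≤-trans (m≤m+n c₁ S) (≤-reflexive (trans sm (+-identityʳ m)))
simulate-fill k a (suc d) zero R m S rest nd lf ak sm = record
  { behind = true ∷ R ; occupied = 0 ; vacant = m
  ; runCars-eq = cong (λ s → runCars k s rest) (advance-occupied R 0 m)
  ; length-behind = refl ; represents = refl , nd , cong (lastHoleStep true) (lf d refl) ; ahead+free = refl ; remaining = sm }
simulate-fill k a (suc d) (suc c₁) R m S rest nd lf ak sm with backwardHole-some R k a (lf d refl) ak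
... | (p , ep) =
  let r = simulate-fill k a d c₁ (fillNearestHole R) m S rest (trans (holeCount-fill R) (cong pred nd)) lf2 ak (+-cancelˡ-≡ 1 _ _ (trans sm (+-suc m d)))
  in record
  { behind = behind r ; occupied = occupied r ; vacant = vacant r
  ; runCars-eq = trans (park-current-backward k R m p (replicate c₁ (suc (length R)) ++ rest) ep)
                 (trans (cong (λ t → runCars k (lot (fillNearestHole R) 1 m) (replicate c₁ (suc t) ++ rest)) (sym (length-fill R))) (runCars-eq r))
  ; length-behind = trans (length-behind r) (cong suc (length-fill R)) ; represents = represents r ; ahead+free = ahead+free r ; remaining = remaining r }
  where
  lf2 : ∀ d₁ → d ≡ suc d₁ → oldestHole (fillNearestHole R) ≡ just a
  lf2 d₁ refl = trans (oldestHole-fill R (subst (2 ≤_) (sym nd) (s≤s (s≤s z≤n)))) (lf (suc d₁) refl)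

simulate-step : ∀ k st R o r c S rest m → Represents st R o → reachable k st ≡ true → o + r ≡ suc m → c + S ≡ r + deficit st →
  Simulation k (lot R o r) (replicate c (suc (length R))) rest (step st c) (suc (length R)) m S
simulate-step k (surplus zero) R .0 .(suc m) zero S rest m (refl , n0) ok refl sm = record
  { behind = false ∷ R ; occupied = 0 ; vacant = m
  ; runCars-eq = cong (λ s → runCars k s rest) (advance-hole R m)
  ; length-behind = refl ; represents = refl , cong suc n0 , cong (lastHoleStep false) (oldestHole-none R n0) ; ahead+free = refl
  ; remaining = trans sm (trans (+-identityʳ _) (+-comm 1 m)) }
simulate-step k (surplus zero) R .0 .(suc m) (suc c₁) S rest m (refl , n0) ok refl sm = record
  { behind = true ∷ R ; occupied = c₁ ; vacant = m ∸ c₁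
  ; runCars-eq = trans (park-current-free k R m (replicate c₁ (suc (length R)) ++ rest)) (trans (park-forward-all k R 0 m c₁ rest n0 c≤) (cong (λ s → runCars k s rest) (advance-occupied R c₁ (m ∸ c₁))))
  ; length-behind = refl ; represents = refl , n0 ; ahead+free = m+[n∸m]≡n c≤
  ; remaining = trans (sym (m+n∸m≡n c₁ S)) (trans (cong (_∸ c₁) sm2) (sym (+-identityʳ _))) }
  where
  sm2 : c₁ + S ≡ m
  sm2 = +-cancelˡ-≡ 1 _ _ (trans sm (+-identityʳ _))
  c≤ : c₁ ≤ m
  c≤ = ≤-trans (m≤m+n c₁ S) (≤-reflexive sm2)
simulate-step k (surplus (suc o₁)) R .(suc o₁) r c S rest m (refl , n0) ok sp sm = record
  { behind = true ∷ R ; occupied = o₁ + c ; vacant = r ∸ c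
  ; runCars-eq = trans (park-forward-all k R o₁ r c rest n0 c≤) (cong (λ s → runCars k s rest) (advance-occupied R (o₁ + c) (r ∸ c)))
  ; length-behind = refl ; represents = refl , n0
  ; ahead+free = trans (+-assoc o₁ c (r ∸ c)) (trans (cong (o₁ +_) (m+[n∸m]≡n c≤)) (+-cancelˡ-≡ 1 _ _ sp))
  ; remaining = trans (sym (m+n∸m≡n c S)) (trans (cong (_∸ c) sm2) (sym (+-identityʳ _))) }
  where
  sm2 : c + S ≡ r
  sm2 = trans sm (+-identityʳ _)
  c≤ : c ≤ r
  c≤ = ≤-trans (m≤m+n c S) (≤-reflexive sm2)
simulate-step k (holes a d) R .0 .(suc m) zero S rest m (refl , nd , la) ok refl sm = record
  { behind = false ∷ R ; occupied = 0 ; vacant = m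
  ; runCars-eq = cong (λ s → runCars k s rest) (advance-hole R m)
  ; length-behind = refl ; represents = refl , cong suc nd , cong (lastHoleStep false) la ; ahead+free = refl
  ; remaining = trans sm (sym (+-suc m d)) }
simulate-step k (holes a d) R .0 .(suc m) (suc c₁) S rest m (refl , nd , la) ok refl sm =
  let pl = simulate-fill k a d c₁ R m S rest nd (λ _ _ → la) (<ᵇ≡true⇒< {a} {k} ok) (+-cancelˡ-≡ 1 _ _ sm)
  in record
  { behind = behind pl ; occupied = occupied pl ; vacant = vacant pl
  ; runCars-eq = trans (park-current-free k R m (replicate c₁ (suc (length R)) ++ rest)) (runCars-eq pl)
  ; length-behind = length-behind pl ; represents = represents pl ; ahead+free = ahead+free pl ; remaining = remaining pl }

simulation-isJust : ∀ k (R : List Bool) c cs {s st m S} (res : Simulation k s (replicate c (suc (length R))) (expand (suc (suc (length R))) cs) st (suc (length R)) m S) →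
  isJust (runCars k s (expand (suc (length R)) (c ∷ cs))) ≡ isJust (runCars k (lot (behind res) (occupied res) (vacant res)) (expand (suc (length (behind res))) cs))
simulation-isJust k R c cs res =
  cong isJust (trans (runCars-eq res) (cong (λ t → runCars k (lot (behind res) (occupied res) (vacant res)) (expand (suc t) cs)) (sym (length-behind res))))

expand-≥ : ∀ j cs → All (j ≤_) (expand j cs)
expand-≥ j [] = []
expand-≥ j (c ∷ cs) = ++⁺ (replicate⁺ c ≤-refl) (All.map (λ le → ≤-trans (n≤1+n j) le) (expand-≥ (suc j) cs))

length-expand : ∀ j cs → length (expand j cs) ≡ sum cs
length-expand j [] = refl
length-expand j (c ∷ cs) = trans (length-++ (replicate c j)) (cong₂ _+_ (length-replicate c) (length-expand (suc j) cs))

carCount-++ : ∀ xs ys → carCount (xs ++ ys) ≡ carCount xs + carCount ys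
carCount-++ [] ys = refl
carCount-++ (true ∷ xs) ys = cong suc (carCount-++ xs ys)
carCount-++ (false ∷ xs) ys = carCount-++ xs ys

carCount-reverse : ∀ R → carCount (reverse R) ≡ carCount R
carCount-reverse [] = refl
carCount-reverse (b ∷ R) = trans (cong carCount (unfold-reverse b R)) (trans (carCount-++ (reverse R) (b ∷ [])) (trans (cong (_+ carCount (b ∷ [])) (carCount-reverse R)) (lem b)))
  where
  lem : ∀ b → carCount R + carCount (b ∷ []) ≡ carCount (b ∷ R)
  lem true = +-comm (carCount R) 1
  lem false = +-identityʳ (carCount R)

carCount-occupied : ∀ o → carCount (replicate o true) ≡ o
carCount-occupied zero = refl
carCount-occupied (suc o) = cong suc (carCount-occupied o)

carCount-free : ∀ r → carCount (replicate r false) ≡ 0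
carCount-free zero = refl
carCount-free (suc r) = carCount-free r

carCount-lot : ∀ R o r → carCount (lot R o r) ≡ carCount R + o
carCount-lot R o r = trans (carCount-++ (reverse R) _) (cong₂ _+_ (carCount-reverse R) (trans (carCount-++ (replicate o true) _) (trans (cong₂ _+_ (carCount-occupied o) (carCount-free r)) (+-identityʳ o))))

+-shuffleF : ∀ t d r L → t + d ≡ L → t + 0 + (r + d) ≡ L + (0 + r)
+-shuffleF t d r L e rewrite sym e | +-identityʳ t | +-comm r d | +-assoc t d r = refl

simulate-stuck : ∀ k st behind occupied vacant cs → Represents st behind occupied → reachable k st ≡ false → sum cs ≡ vacant + deficit st →
  isJust (runCars k (lot behind occupied vacant) (expand (suc (length behind)) cs)) ≡ false
simulate-stuck k (surplus x) behind occupied vacant cs gd ()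
simulate-stuck k (holes a d) behind .0 vacant cs (refl , nd , la) nok sc with oldestHole-free behind (ahead 0 vacant) a la
... | (aR , fr) = cong isJust (runCars-stuck k (lot behind 0 vacant) (expand (suc (length behind)) cs) (length behind ∸ a) fr
        (All.map (λ {x} le → ≤-trans (s≤s pk) le) (expand-≥ (suc (length behind)) cs))
        (trans (cong₂ _+_ (carCount-lot behind 0 vacant) (trans (length-expand (suc (length behind)) cs) sc))
          (trans (+-shuffleF (carCount behind) d vacant (length behind) (trans (cong (carCount behind +_) (sym nd)) (carCount+holeCount behind))) (sym (length-lot behind 0 vacant)))))
  where
  pk : length behind ∸ a + k ≤ length behind
  pk = ≤-trans (+-monoʳ-≤ (length behind ∸ a) (<ᵇ≡false⇒≥ {a} {k} nok)) (≤-reflexive (m∸n+n≡m (<⇒≤ aR)))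

simulate : ∀ k st R o r cs → Represents st R o → reachable k st ≡ true → length cs ≡ o + r → sum cs ≡ r + deficit st →
  isJust (runCars k (lot R o r) (expand (suc (length R)) cs)) ≡ accepts k st cs
simulate k (surplus zero) R .0 zero [] (refl , n0) ok ln sm = refl
simulate k (surplus zero) R .0 (suc r) [] (refl , n0) ok () sm
simulate k (surplus (suc o₁)) R .(suc o₁) r [] (refl , n0) ok () sm
simulate k (holes a d) R .0 r [] (refl , nd , la) ok ln sm = ⊥-elim (<⇒≱ (subst (1 ≤_) nd (oldestHole⇒holeCount R a la)) (≤-trans (m≤n+m d r) (≤-reflexive (sym sm))))
simulate k st R o r (c ∷ cs) gd ok ln sm
  with simulate-step k st R o r c (sum cs) (expand (suc (suc (length R))) cs) (length cs) gd ok (sym ln) sm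
     | reachable k (step st c) in reach
... | res | true = trans (simulation-isJust k R c cs res) (simulate k (step st c) (behind res) (occupied res) (vacant res) cs (represents res) reach (sym (ahead+free res)) (remaining res))
... | res | false = trans (simulation-isJust k R c cs res) (simulate-stuck k (step st c) (behind res) (occupied res) (vacant res) cs (represents res) reach (remaining res))

-- Ascending preference lists as content vectors

sumBelow : ℕ → (ℕ → ℕ) → ℕ
sumBelow zero f = 0
sumBelow (suc n) f = f 0 + sumBelow n (f ∘ suc)

sumBy-applyUpTo : ∀ (f : ℕ → ℕ) g n → sumBy f (applyUpTo g n) ≡ sumBelow n (f ∘ g)
sumBy-applyUpTo f g zero = refl
sumBy-applyUpTo f g (suc n) = cong (f (g 0) +_) (sumBy-applyUpTo f (g ∘ suc) n)

sumBelow-cong : ∀ n {f g : ℕ → ℕ} → (∀ i → f i ≡ g i) → sumBelow n f ≡ sumBelow n g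
sumBelow-cong zero e = refl
sumBelow-cong (suc n) e = cong₂ _+_ (e 0) (sumBelow-cong n (λ i → e (suc i)))

above : ℕ → ℕ → ℕ
above l i = indicator (suc l ≤ᵇ suc i)

sumBelow-above : ∀ n l f → l < n → sumBelow n (λ i → above l i * f i) ≡ f l + sumBelow n (λ i → above (suc l) i * f i)
sumBelow-above (suc n) zero f lt = cong (_+ sumBelow n (λ i → 1 * f (suc i))) (+-identityʳ (f 0))
sumBelow-above (suc n) (suc l) f (s≤s lt) = sumBelow-above n l (λ i → f (suc i)) lt

sumBelow-above-none : ∀ n f → sumBelow n (λ i → above n i * f i) ≡ 0
sumBelow-above-none zero f = refl
sumBelow-above-none (suc n) f = sumBelow-above-none n (λ i → f (suc i))

headAtLeast : ℕ → List ℕ → Bool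
headAtLeast lo [] = true
headAtLeast lo (a ∷ _) = lo ≤ᵇ a

ascendingFrom : ℕ → List ℕ → Bool
ascendingFrom lo α = headAtLeast lo α ∧ ascending α

ascending-∷ : ∀ a β → ascending (a ∷ β) ≡ ascendingFrom a β
ascending-∷ a [] = refl
ascending-∷ a (b ∷ β) = refl

countAsc : ℕ → ℕ → ℕ → (List ℕ → Bool) → ℕ
countAsc n lo m P = count (λ α → ascendingFrom lo α ∧ P α) (prefs n m)

countAsc-suc : ∀ n lo m P → countAsc n lo (suc m) P ≡ sumBelow n (λ i → indicator (lo ≤ᵇ suc i) * countAsc n (suc i) m (λ β → P (suc i ∷ β)))
countAsc-suc n lo m P =
  trans (count-concatMap _ (λ a → map (a ∷_) (prefs n m)) (map suc (upTo n)))
  (trans (sumBy-map _ suc (upTo n))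
  (trans (sumBy-applyUpTo _ (λ i → i) n)
  (sumBelow-cong n (λ i → trans (count-map _ (suc i ∷_) (prefs n m))
    (trans (count-cong (prefs n m) (λ β → trans (cong (λ t → ((lo ≤ᵇ suc i) ∧ t) ∧ P (suc i ∷ β)) (ascending-∷ (suc i) β)) (∧-assoc (lo ≤ᵇ suc i) (ascendingFrom (suc i) β) (P (suc i ∷ β)))))
    (count-∧ˡ (lo ≤ᵇ suc i) _ (prefs n m)))))))

countAsc-split : ∀ n l m P → l < n → countAsc n (suc l) (suc m) P ≡ countAsc n (suc l) m (λ β → P (suc l ∷ β)) + countAsc n (suc (suc l)) (suc m) P
countAsc-split n l m P lt =
  trans (countAsc-suc n (suc l) m P)
  (trans (sumBelow-above n l (λ i → countAsc n (suc i) m (λ β → P (suc i ∷ β))) lt)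
  (cong (countAsc n (suc l) m (λ β → P (suc l ∷ β)) +_) (sym (countAsc-suc n (suc (suc l)) m P))))

countAsc-beyond : ∀ n m P → countAsc n (suc n) (suc m) P ≡ 0
countAsc-beyond n m P = trans (countAsc-suc n (suc n) m P) (sumBelow-above-none n _)

countAsc-zero : ∀ n lo P → countAsc n lo 0 P ≡ indicator (P [])
countAsc-zero n lo P with P []
... | true = refl
... | false = refl

countAsc-multiplicity : ∀ n l m P → l < n → countAsc n (suc l) m P ≡ sumTo m (λ c → countAsc n (suc (suc l)) (m ∸ c) (λ β → P (replicate c (suc l) ++ β)))
countAsc-multiplicity n l zero P lt = trans (countAsc-zero n (suc l) P) (sym (countAsc-zero n (suc (suc l)) P))
countAsc-multiplicity n l (suc m) P lt =
  trans (countAsc-split n l m P lt)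
  (trans (cong (_+ countAsc n (suc (suc l)) (suc m) P) (countAsc-multiplicity n l m (λ β → P (suc l ∷ β)) lt))
  (trans (+-comm _ (countAsc n (suc (suc l)) (suc m) P))
  (sym (sumTo-uncons m _))))

+≡ᵇ-∸ : ∀ c s m → c ≤ m → (c + s ≡ᵇ m) ≡ (s ≡ᵇ m ∸ c)
+≡ᵇ-∸ zero s m le = refl
+≡ᵇ-∸ (suc c) s (suc m) (s≤s le) = +≡ᵇ-∸ c s m le

+≡ᵇ-large : ∀ c s m → m < c → (c + s ≡ᵇ m) ≡ false
+≡ᵇ-large (suc c) s zero lt = refl
+≡ᵇ-large (suc c) s (suc m) (s≤s lt) = +≡ᵇ-large c s m lt

count-singleton : (b : Bool) → count {List ℕ} (λ _ → b) ([] ∷ []) ≡ indicator b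
count-singleton true = refl
count-singleton false = refl

suc-+0-injective : ∀ l n → suc l + 0 ≡ suc n → l ≡ n
suc-+0-injective l n e = +-cancelˡ-≡ 1 _ _ (trans (sym (+-identityʳ (suc l))) e)

countAsc≡count-box : ∀ n p l → suc l + p ≡ suc n → ∀ m M P → m ≤ M → countAsc n (suc l) m P ≡ count (λ cs → (sum cs ≡ᵇ m) ∧ P (expand (suc l) cs)) (box p M)
countAsc≡count-box n zero l e m M P le with suc-+0-injective l n e
countAsc≡count-box n zero .n e zero M P le | refl = trans (countAsc-zero n (suc n) P) (sym (count-singleton (P [])))
countAsc≡count-box n zero .n e (suc m) M P le | refl = countAsc-beyond n m P
countAsc≡count-box n (suc p) l e m M P le =
  trans (countAsc-multiplicity n l m P l<n)
  (trans (sumTo-cong m (λ c c≤ → trans (countAsc≡count-box n p (suc l) (trans (sym (+-suc (suc l) p)) e) (m ∸ c) M (λ β → P (replicate c (suc l) ++ β)) (≤-trans (m∸n≤m m c) le))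
                                       (count-cong (box p M) (λ cs → cong (λ t → t ∧ P (replicate c (suc l) ++ expand (suc (suc l)) cs)) (sym (+≡ᵇ-∸ c (sum cs) m c≤))))))
  (trans (sym (sumTo-padZeros m M _ le (λ c lt → count-none _ (box p M) (λ cs → cong (_∧ P (replicate c (suc l) ++ expand (suc (suc l)) cs)) (+≡ᵇ-large c (sum cs) m lt)))))
  (sym (count-box-uncons p M _))))
  where
  l<n : l < n
  l<n = ≤-trans (s≤s (m≤m+n l p)) (≤-reflexive (+-cancelˡ-≡ 1 _ _ (trans (sym (+-suc (suc l) p)) e)))

-- Splitting a (k₀ + 1)-accepted content vector

-- A content vector accepted under k₀ + 1 but not under k₀ gets stuck under k₀
-- exactly when the oldest hole reaches age k₀.  Cutting at the spot that hole was
-- opened splits it into a k₀-accepted prefix, a block of k₀ + 1 spots that drives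
-- `start` to a stuck state, and a (k₀ + 1)-accepted rest (`splitsAt`).
-- `pendingSplit` accounts for a block that began before the current position.
stuck : ℕ → Maybe State → Bool
stuck k₀ nothing = false
stuck k₀ (just s) = not (reachable k₀ s)

stuckThen : ℕ → Maybe State → List ℕ → Bool
stuckThen k₀ nothing r = false
stuckThen k₀ (just s) r = not (reachable k₀ s) ∧ accepts (suc k₀) s r

splitWith : ℕ → (List ℕ → Bool) → ℕ → List ℕ → Bool
splitWith k₀ P i cs = P (take i cs) ∧ stuckThen k₀ (trace (suc k₀) start (take (suc k₀) (drop i cs))) (drop (suc k₀) (drop i cs))

splitsAt : ℕ → State → ℕ → List ℕ → Bool
splitsAt k₀ st = splitWith k₀ (accepts k₀ st)

pendingSplit : ℕ → State → List ℕ → ℕ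
pendingSplit k₀ (surplus _) cs = 0
pendingSplit k₀ (holes a d) cs = indicator (stuckThen k₀ (trace (suc k₀) (holes a d) (take (k₀ ∸ a) cs)) (drop (k₀ ∸ a) cs))

stuck-surplus : ∀ k₀ o b → length b ≤ k₀ → stuck k₀ (trace (suc k₀) (surplus o) b) ≡ false
stuck-surplus k₀ o b le with trace (suc k₀) (surplus o) b in eq
... | nothing = refl
... | just (surplus x) = refl
... | just (holes a d) rewrite <⇒<ᵇ≡true {a} {k₀} (≤-trans (age<length-surplus (suc k₀) o b a d eq) le) = refl

stuckThen-surplus : ∀ k₀ o b r → length b ≤ k₀ → stuckThen k₀ (trace (suc k₀) (surplus o) b) r ≡ false
stuckThen-surplus k₀ o b r le = notStuck (trace (suc k₀) (surplus o) b) (stuck-surplus k₀ o b le)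
  where
  notStuck : ∀ t → stuck k₀ t ≡ false → stuckThen k₀ t r ≡ false
  notStuck nothing e = refl
  notStuck (just s) e rewrite e = refl

splits-reachable : ∀ k₀ st c cs → reachable k₀ (step st c) ≡ true →
  sumTo (length (c ∷ cs)) (λ i → indicator (splitsAt k₀ st i (c ∷ cs))) ≡ indicator (splitsAt k₀ st 0 (c ∷ cs)) + sumTo (length cs) (λ i → indicator (splitsAt k₀ (step st c) i cs))
splits-reachable k₀ st c cs ok = trans (sumTo-uncons (length cs) _) (cong (indicator (splitsAt k₀ st 0 (c ∷ cs)) +_) (sumTo-cong (length cs) (λ i _ → e i)))
  where
  e : ∀ i → indicator (splitsAt k₀ st (suc i) (c ∷ cs)) ≡ indicator (splitsAt k₀ (step st c) i cs)
  e i rewrite ok = refl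

splits-unreachable : ∀ k₀ st c cs → reachable k₀ (step st c) ≡ false →
  sumTo (length (c ∷ cs)) (λ i → indicator (splitsAt k₀ st i (c ∷ cs))) ≡ indicator (splitsAt k₀ st 0 (c ∷ cs))
splits-unreachable k₀ st c cs nok = trans (sumTo-uncons (length cs) _) (trans (cong (indicator (splitsAt k₀ st 0 (c ∷ cs)) +_) (sumTo-zero (length cs) _ (λ i _ → e i))) (+-identityʳ _))
  where
  e : ∀ i → indicator (splitsAt k₀ st (suc i) (c ∷ cs)) ≡ 0
  e i rewrite nok = refl

m∸n≡suc[m∸suc[n]] : ∀ k a → a < k → k ∸ a ≡ suc (k ∸ suc a)
m∸n≡suc[m∸suc[n]] (suc k) zero lt = refl
m∸n≡suc[m∸suc[n]] (suc k) (suc a) (s≤s lt) = m∸n≡suc[m∸suc[n]] k a lt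

+-shuffle : ∀ R S f0 E E₁ → E₁ ≡ f0 + E → R + S + E₁ ≡ R + (f0 + S) + E
+-shuffle R S f0 E E₁ refl rewrite +-comm f0 S | +-assoc R S (f0 + E) | +-assoc R (S + f0) E | +-assoc S f0 E = refl

Decomposes : ℕ → State → List ℕ → Set
Decomposes k₀ st cs = indicator (accepts (suc k₀) st cs) ≡ indicator (accepts k₀ st cs) + sumTo (length cs) (λ i → indicator (splitsAt k₀ st i cs)) + pendingSplit k₀ st cs

PendingStep : ℕ → State → ℕ → List ℕ → Set
PendingStep k₀ st c cs = pendingSplit k₀ (step st c) cs ≡ indicator (splitsAt k₀ st 0 (c ∷ cs)) + pendingSplit k₀ st (c ∷ cs)

decompose-step : ∀ k₀ st c cs → reachable k₀ (step st c) ≡ true → PendingStep k₀ st c cs →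
  Decomposes k₀ (step st c) cs →
  Decomposes k₀ st (c ∷ cs)
decompose-step k₀ st c cs ok exEq IH =
  trans (cong (λ b → indicator (b ∧ accepts (suc k₀) (step st c) cs)) (reachable-suc k₀ (step st c) ok))
  (trans IH (trans (+-shuffle (indicator (accepts k₀ (step st c) cs)) (sumTo (length cs) (λ i → indicator (splitsAt k₀ (step st c) i cs)))
                               (indicator (splitsAt k₀ st 0 (c ∷ cs))) (pendingSplit k₀ st (c ∷ cs)) _ exEq)
    (cong₂ (λ u t → u + t + pendingSplit k₀ st (c ∷ cs)) (cong (λ b → indicator (b ∧ accepts k₀ (step st c) cs)) (sym ok)) (sym (splits-reachable k₀ st c cs ok)))))

pendingSplit-surplus : ∀ k₀ a d c cs o → a < k₀ → step (holes a d) c ≡ surplus o → PendingStep k₀ (holes a d) c cs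
pendingSplit-surplus k₀ a d c cs o lt eq rewrite m∸n≡suc[m∸suc[n]] k₀ a lt | eq =
  sym (cong indicator (stuckThen-surplus k₀ o (take (k₀ ∸ suc a) cs) _ (≤-trans (≤-reflexive (length-take (k₀ ∸ suc a) cs)) (≤-trans (m⊓n≤m _ _) (m∸n≤m k₀ (suc a))))))

pendingSplit-holes : ∀ k₀ a d c cs d₁ → (a <ᵇ k₀) ≡ true → step (holes a d) c ≡ holes (suc a) d₁ → PendingStep k₀ (holes a d) c cs
pendingSplit-holes k₀ a d c cs d₁ ok eq rewrite m∸n≡suc[m∸suc[n]] k₀ a (<ᵇ≡true⇒< {a} {k₀} ok) | eq | ok = refl

decompose-stuck : ∀ k₀ a d c cs d₁ → (a <ᵇ k₀) ≡ true → step (holes a d) c ≡ holes (suc a) d₁ → (suc a <ᵇ k₀) ≡ false →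
  Decomposes k₀ (holes a d) (c ∷ cs)
decompose-stuck k₀ a d c cs d₁ ok eq nok
  rewrite splits-unreachable k₀ (holes a d) c cs (trans (cong (reachable k₀) eq) nok)
        | m∸n≡suc[m∸suc[n]] k₀ a (<ᵇ≡true⇒< {a} {k₀} ok)
        | m≤n⇒m∸n≡0 (<ᵇ≡false⇒≥ {suc a} {k₀} nok)
        | eq | ok = sym (cong (λ b → indicator (b ∧ accepts k₀ (holes (suc a) d₁) cs) + 0 + indicator (not b ∧ accepts (suc k₀) (holes (suc a) d₁) cs)) nok)

decompose : ∀ k₀ st cs → reachable k₀ st ≡ true →
  Decomposes k₀ st cs
decompose k₀ (surplus zero) [] ok = refl
decompose k₀ (surplus (suc o)) [] ok = refl
decompose k₀ (holes a d) [] ok rewrite take-[] {A = ℕ} (k₀ ∸ a) | ok = refl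
decompose zero (surplus zero) (zero ∷ cs) ok = trans (sym (+-identityʳ _)) (cong (_+ 0) (sym (splits-unreachable zero (surplus zero) zero cs refl)))
decompose (suc k₀) (surplus zero) (zero ∷ cs) ok = decompose-step (suc k₀) (surplus zero) zero cs refl (sym (+-identityʳ _)) (decompose (suc k₀) (holes 0 1) cs refl)
decompose k₀ (surplus zero) (suc c ∷ cs) ok =
  decompose-step k₀ (surplus zero) (suc c) cs refl
    (sym (trans (+-identityʳ _) (cong indicator (stuckThen-surplus k₀ c (take k₀ cs) _ (≤-trans (≤-reflexive (length-take k₀ cs)) (m⊓n≤m k₀ _))))))
    (decompose k₀ (surplus c) cs refl)
decompose k₀ (surplus (suc o)) (c ∷ cs) ok = decompose-step k₀ (surplus (suc o)) c cs refl refl (decompose k₀ (surplus (o + c)) cs refl)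
decompose k₀ (holes a d) (c ∷ cs) ok with step-holes-shape a d c
... | inj₁ (o , eq) =
  decompose-step k₀ (holes a d) c cs (cong (reachable k₀) eq) (pendingSplit-surplus k₀ a d c cs o (<ᵇ≡true⇒< {a} {k₀} ok) eq)
    (decompose k₀ (step (holes a d) c) cs (cong (reachable k₀) eq))
... | inj₂ (d₁ , eq) with suc a <ᵇ k₀ in ok2
...   | true = decompose-step k₀ (holes a d) c cs (trans (cong (reachable k₀) eq) ok2) (pendingSplit-holes k₀ a d c cs d₁ ok eq) (decompose k₀ (step (holes a d) c) cs (trans (cong (reachable k₀) eq) ok2))
...   | false = decompose-stuck k₀ a d c cs d₁ ok eq ok2

n<ᵇn≡false : ∀ n → (n <ᵇ n) ≡ false
n<ᵇn≡false zero = refl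
n<ᵇn≡false (suc n) = n<ᵇn≡false n

headPositive : List ℕ → Bool
headPositive [] = false
headPositive (zero ∷ _) = false
headPositive (suc _ ∷ _) = true

countU : ℕ → ℕ → ℕ → ℕ
countU k m M = count (λ q → headPositive q ∧ accepts k start q) (box m M)

count-decompose : ∀ k₀ n M → count (accepts (suc k₀) start) (box n M) ≡ count (accepts k₀ start) (box n M) + sumTo n (λ i → count (splitsAt k₀ start i) (box n M))
count-decompose k₀ n M = count-box-+-sumTo n M _ _ _ (λ cs len → trans (decompose k₀ start cs refl) (trans (+-identityʳ _) (cong (λ t → _ + sumTo t _) len)))

count-surplus-large : ∀ k m M t → m < t → count (accepts k (surplus t)) (box m M) ≡ 0
count-surplus-large k m M t m<t = count-box-none m M _ rejects
  where
  rejects : ∀ cs → length cs ≡ m → accepts k (surplus t) cs ≡ false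
  rejects cs len with accepts k (surplus t) cs in acc
  ... | false = refl
  ... | true = ⊥-elim (<⇒≱ m<t (≤-trans (m≤m+n t (sum cs)) (≤-reflexive (trans (accepts-balance k (surplus t) cs acc) len))))

countU-suc-box : ∀ k m M → m ≤ M → countU k (suc m) (suc M) ≡ sumTo m (λ t → count (accepts k (surplus t)) (box m (suc M)))
countU-suc-box k m M m≤M = begin
  countU k (suc m) (suc M)
    ≡⟨ trans (count-box-uncons m (suc M) _) (sumTo-uncons M _) ⟩
  count (λ _ → false) (box m (suc M)) + sumTo M R
    ≡⟨ cong (_+ sumTo M R) (count-none _ (box m (suc M)) (λ _ → refl)) ⟩
  sumTo M R
    ≡⟨ sumTo-padZeros m M R m≤M (count-surplus-large k m (suc M)) ⟩
  sumTo m R ∎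
  where
  R : ℕ → ℕ
  R t = count (accepts k (surplus t)) (box m (suc M))

shiftBy : ℕ → (ℕ → ℕ) → ℕ → ℕ
shiftBy zero R c = R c
shiftBy (suc d) R zero = 0
shiftBy (suc d) R (suc c) = shiftBy d R c

sumTo-shiftBy : ∀ d N R → sumTo (d + N) (shiftBy d R) ≡ sumTo N R
sumTo-shiftBy zero N R = refl
sumTo-shiftBy (suc d) N R = trans (sumTo-uncons (d + N) (shiftBy (suc d) R)) (sumTo-shiftBy d N R)

count-fill : ∀ k₀ m₁ M d c → count (λ q → reachable (suc k₀) (fill k₀ d c) ∧ accepts (suc k₀) (fill k₀ d c) q) (box m₁ M) ≡ shiftBy d (λ t → count (accepts (suc k₀) (surplus t)) (box m₁ M)) c
count-fill k₀ m₁ M zero c = refl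
count-fill k₀ m₁ M (suc d) zero = count-none _ (box m₁ M) (λ q → cong (_∧ accepts (suc k₀) (fill k₀ (suc d) zero) q) (n<ᵇn≡false k₀))
count-fill k₀ m₁ M (suc d) (suc c) = count-fill k₀ m₁ M d c

count-holes-at-limit-suc : ∀ k₀ d m M → m + d ≤ M → count (accepts (suc k₀) (holes k₀ d)) (box (suc m) (suc M)) ≡ sumTo m (λ t → count (accepts (suc k₀) (surplus t)) (box m (suc M)))
count-holes-at-limit-suc k₀ d m M m+d≤M = begin
  count (accepts (suc k₀) (holes k₀ d)) (box (suc m) (suc M))
    ≡⟨ trans (count-box-uncons m (suc M) _) (sumTo-uncons M _) ⟩
  count (λ q → (k₀ <ᵇ k₀) ∧ accepts (suc k₀) (holes (suc k₀) (suc d)) q) (box m (suc M))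
    + sumTo M (λ c → count (λ q → reachable (suc k₀) (fill k₀ d c) ∧ accepts (suc k₀) (fill k₀ d c) q) (box m (suc M)))
    ≡⟨ cong₂ _+_ (count-none _ (box m (suc M)) (λ q → cong (_∧ accepts (suc k₀) (holes (suc k₀) (suc d)) q) (n<ᵇn≡false k₀))) (sumTo-cong M (λ c _ → count-fill k₀ m (suc M) d c)) ⟩
  sumTo M (shiftBy d R)
    ≡⟨ cong (λ t → sumTo t (shiftBy d R)) (sym (m+[n∸m]≡n d≤M)) ⟩
  sumTo (d + (M ∸ d)) (shiftBy d R)
    ≡⟨ sumTo-shiftBy d (M ∸ d) R ⟩
  sumTo (M ∸ d) R
    ≡⟨ sumTo-padZeros m (M ∸ d) R m≤M∸d (count-surplus-large (suc k₀) m (suc M)) ⟩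
  sumTo m R ∎
  where
  R : ℕ → ℕ
  R t = count (accepts (suc k₀) (surplus t)) (box m (suc M))
  d≤M : d ≤ M
  d≤M = ≤-trans (m≤n+m d m) m+d≤M
  m≤M∸d : m ≤ M ∸ d
  m≤M∸d = ≤-trans (≤-reflexive (sym (m+n∸n≡m m d))) (∸-monoˡ-≤ d m+d≤M)

-- Age k₀ is the limit for k₀ + 1: the next spot must receive a car, after which
-- the holes are filled and the surplus left over is what a positive first entry
-- from `start` leaves.
count-holes-at-limit : ∀ k₀ d m M → m + d ≤ M → count (accepts (suc k₀) (holes k₀ d)) (box m M) ≡ countU (suc k₀) m M
count-holes-at-limit k₀ d zero M _ = refl
count-holes-at-limit k₀ d (suc m) (suc M) (s≤s m+d≤M) =
  trans (count-holes-at-limit-suc k₀ d m M m+d≤M) (sym (countU-suc-box (suc k₀) m M (≤-trans (m≤m+n m d) m+d≤M)))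

blocks : ℕ → ℕ → ℕ
blocks k₀ M = count (λ b → stuck k₀ (trace (suc k₀) start b)) (box (suc k₀) M)

count-stuckThen : ∀ k₀ m M b → m + suc k₀ ≤ M → count (stuckThen k₀ (trace (suc k₀) start b)) (box m M) ≡ indicator (stuck k₀ (trace (suc k₀) start b)) * countU (suc k₀) m M
count-stuckThen k₀ m M b le with trace (suc k₀) start b in eq
... | nothing = count-none _ (box m M) (λ _ → refl)
... | just (surplus o) = count-none _ (box m M) (λ _ → refl)
... | just (holes a d) with a <ᵇ k₀ in eq2
...   | true = count-none _ (box m M) (λ _ → refl)
...   | false = trans (subst (λ a → count (accepts (suc k₀) (holes a d)) (box m M) ≡ countU (suc k₀) m M) (sym a≡) (count-holes-at-limit k₀ d m M (≤-trans (+-monoʳ-≤ m d≤) le))) (sym (+-identityʳ _))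
  where
  a< : a < suc k₀
  a< = <ᵇ≡true⇒< {a} {suc k₀} (trace-reachable (suc k₀) start b (holes a d) eq refl)
  a≡ : a ≡ k₀
  a≡ = ≤-antisym (≤-pred a<) (<ᵇ≡false⇒≥ {a} {k₀} eq2)
  d≤ : d ≤ suc k₀
  d≤ = subst (λ x → d ≤ suc x) a≡ (proj₁ (trace-wellFormed (suc k₀) start b (holes a d) eq _))

count-split-block : ∀ k₀ i m M (P : List ℕ → Bool) → m + suc k₀ ≤ M →
  count (splitWith k₀ P i) (box (i + (suc k₀ + m)) M)
  ≡ count P (box i M) * (blocks k₀ M * countU (suc k₀) m M)
count-split-block k₀ i m M P le =
  trans (count-split i (suc k₀ + m) M (λ x y → P x ∧ stuckThen k₀ (trace (suc k₀) start (take (suc k₀) y)) (drop (suc k₀) y)))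
  (trans (sumBy-cong (box i M) (λ x → count-∧ˡ (P x) _ (box (suc k₀ + m) M)))
  (trans (sumBy-count-* P _ (box i M))
  (cong (count P (box i M) *_)
    (trans (count-split (suc k₀) m M (λ b r → stuckThen k₀ (trace (suc k₀) start b) r))
    (trans (sumBy-cong (box (suc k₀) M) (λ b → count-stuckThen k₀ m M b le))
    (sumBy-count-* (λ b → stuck k₀ (trace (suc k₀) start b)) _ (box (suc k₀) M)))))))

m∸n≤suc[m∸suc[n]] : ∀ n i → n ∸ i ≤ suc (n ∸ suc i)
m∸n≤suc[m∸suc[n]] zero zero = z≤n
m∸n≤suc[m∸suc[n]] zero (suc i) = z≤n
m∸n≤suc[m∸suc[n]] (suc n) zero = s≤s (≤-reflexive refl)
m∸n≤suc[m∸suc[n]] (suc n) (suc i) = m∸n≤suc[m∸suc[n]] n i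

m∸suc[k]<i⇒m∸i≤k : ∀ n k i → n ∸ suc k < i → n ∸ i ≤ k
m∸suc[k]<i⇒m∸i≤k zero k i lt = ≤-trans (≤-reflexive (0∸n≡0 i)) z≤n
m∸suc[k]<i⇒m∸i≤k (suc n) zero i lt = ≤-reflexive (m≤n⇒m∸n≡0 lt)
m∸suc[k]<i⇒m∸i≤k (suc n) (suc k) zero ()
m∸suc[k]<i⇒m∸i≤k (suc n) (suc k) (suc i) lt = ≤-trans (m∸n≤suc[m∸suc[n]] n i) (s≤s (m∸suc[k]<i⇒m∸i≤k n k (suc i) lt))

length-split : ∀ n k i → k ≤ n → i ≤ n ∸ k → n ≡ i + (k + (n ∸ k ∸ i))
length-split n k i kn le = sym (begin
  i + (k + (n ∸ k ∸ i)) ≡⟨ cong (i +_) (+-comm k _) ⟩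
  i + ((n ∸ k ∸ i) + k) ≡⟨ sym (+-assoc i _ k) ⟩
  i + (n ∸ k ∸ i) + k ≡⟨ cong (_+ k) (m+[n∸m]≡n le) ⟩
  n ∸ k + k ≡⟨ m∸n+n≡m kn ⟩
  n ∎)

suffix+block≤bound : ∀ n k i M → k ≤ n → n ≤ M → n ∸ k ∸ i + k ≤ M
suffix+block≤bound n k i M kn nM = ≤-trans (+-monoˡ-≤ k (m∸n≤m (n ∸ k) i)) (≤-trans (≤-reflexive (m∸n+n≡m kn)) nM)

sum-splits : ∀ k₀ n M (P : List ℕ → Bool) → suc k₀ ≤ n → n ≤ M →
  sumTo n (λ i → count (splitWith k₀ P i) (box n M))
  ≡ sumTo (n ∸ suc k₀) (λ i → count P (box i M) * (blocks k₀ M * countU (suc k₀) (n ∸ suc k₀ ∸ i) M))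
sum-splits k₀ n M P kn nM =
  trans (sumTo-padZeros (n ∸ suc k₀) n _ (m∸n≤m n (suc k₀)) zeros)
  (sumTo-cong (n ∸ suc k₀) (λ i le → trans (cong (λ t → count (splitWith k₀ P i) (box t M)) (nEq i le))
    (count-split-block k₀ i (n ∸ suc k₀ ∸ i) M P (mle i le))))
  where
  zeros : ∀ i → n ∸ suc k₀ < i → count (splitWith k₀ P i) (box n M) ≡ 0
  zeros i lt = count-box-none n M _ (λ cs e → trans (cong (P (take i cs) ∧_) (stuckThen-surplus k₀ 0 (take (suc k₀) (drop i cs)) _ (lenle cs e))) (∧-zeroʳ _))
    where
    lenle : ∀ cs → length cs ≡ n → length (take (suc k₀) (drop i cs)) ≤ k₀
    lenle cs e = ≤-trans (≤-reflexive (length-take (suc k₀) (drop i cs))) (≤-trans (m⊓n≤n _ _) (≤-trans (≤-reflexive (trans (length-drop i cs) (cong (_∸ i) e))) (≤-pred small)))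
      where
      small : n ∸ i < suc k₀
      small = s≤s (m∸suc[k]<i⇒m∸i≤k n k₀ i lt)
  nEq : ∀ i → i ≤ n ∸ suc k₀ → n ≡ i + (suc k₀ + (n ∸ suc k₀ ∸ i))
  nEq i le = length-split n (suc k₀) i kn le
  mle : ∀ i → i ≤ n ∸ suc k₀ → n ∸ suc k₀ ∸ i + suc k₀ ≤ M
  mle i le = suffix+block≤bound n (suc k₀) i M kn nM

decompose-headPositive : ∀ k₀ cs →
  indicator (headPositive cs ∧ accepts (suc k₀) start cs)
    ≡ indicator (headPositive cs ∧ accepts k₀ start cs) + sumTo (length cs) (λ i → indicator (headPositive (take i cs) ∧ splitsAt k₀ start i cs))
decompose-headPositive k₀ [] = refl
decompose-headPositive k₀ (zero ∷ cs) = sym (sumTo-zero (length (zero ∷ cs)) _ f)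
  where
  f : ∀ i → i ≤ length (zero ∷ cs) → indicator (headPositive (take i (zero ∷ cs)) ∧ splitsAt k₀ start i (zero ∷ cs)) ≡ 0
  f zero _ = refl
  f (suc i) _ = refl
decompose-headPositive k₀ (suc x ∷ cs) =
  trans (decompose k₀ start (suc x ∷ cs) refl)
  (trans (+-identityʳ _)
  (cong (indicator (accepts k₀ start (suc x ∷ cs)) +_) (sumTo-cong (length (suc x ∷ cs)) f)))
  where
  f : ∀ i → i ≤ length (suc x ∷ cs) → indicator (splitsAt k₀ start i (suc x ∷ cs)) ≡ indicator (headPositive (take i (suc x ∷ cs)) ∧ splitsAt k₀ start i (suc x ∷ cs))
  f zero _ = cong indicator (stuckThen-surplus k₀ x (take k₀ cs) _ (≤-trans (≤-reflexive (length-take k₀ cs)) (m⊓n≤m k₀ _)))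
  f (suc i) _ = refl

count-accepts-suc : ∀ k₀ n M → suc k₀ ≤ n → n ≤ M →
  count (accepts (suc k₀) start) (box n M) ≡ count (accepts k₀ start) (box n M) + sumTo (n ∸ suc k₀) (λ i → count (accepts k₀ start) (box i M) * (blocks k₀ M * countU (suc k₀) (n ∸ suc k₀ ∸ i) M))
count-accepts-suc k₀ n M kn nM = trans (count-decompose k₀ n M) (cong (count (accepts k₀ start) (box n M) +_) (sum-splits k₀ n M (accepts k₀ start) kn nM))

count-decompose-headPositive : ∀ k₀ n M → countU (suc k₀) n M ≡ countU k₀ n M + sumTo n (λ i → count (λ cs → headPositive (take i cs) ∧ splitsAt k₀ start i cs) (box n M))
count-decompose-headPositive k₀ n M = count-box-+-sumTo n M _ _ _ (λ cs len → trans (decompose-headPositive k₀ cs) (cong (λ t → _ + sumTo t _) len))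

countU-suc : ∀ k₀ n M → suc k₀ ≤ n → n ≤ M →
  countU (suc k₀) n M ≡ countU k₀ n M + sumTo (n ∸ suc k₀) (λ i → countU k₀ i M * (blocks k₀ M * countU (suc k₀) (n ∸ suc k₀ ∸ i) M))
countU-suc k₀ n M kn nM = trans (count-decompose-headPositive k₀ n M) (cong (countU k₀ n M +_)
  (trans (sumTo-cong n (λ i _ → count-cong (box n M) (λ cs → sym (∧-assoc (headPositive (take i cs)) (accepts k₀ start (take i cs)) _))))
  (sum-splits k₀ n M (λ x → headPositive x ∧ accepts k₀ start x) kn nM)))

-- Ballot and Catalan numbers

fillWeight : (ℕ → ℕ) → ℕ → ℕ → ℕ
fillWeight f zero c = 0
fillWeight f (suc d) zero = f (suc d)
fillWeight f (suc d) (suc c) = fillWeight f d c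

-- `blockCount L d` counts the ways to finish a block with L spots to go from a
-- state with d holes so that the oldest hole ends exactly at the reach limit.
-- These are ballot numbers: blockCount L (h + 1) = C(2L+h+1, L+h+1) − C(2L+h+1, L+h+2)
-- (`blockCount-ballot`), so blockCount L 1 is the Catalan number C_(L+1).
blockCount : ℕ → ℕ → ℕ
blockCount zero d = 1
blockCount (suc L) d = blockCount L (suc d) + sumTo (pred d) (fillWeight (blockCount L) d)

blockCount-step : ∀ L d → blockCount (suc L) (suc (suc d)) ≡ blockCount L (suc (suc (suc d))) + blockCount (suc L) (suc d)
blockCount-step L d = cong (blockCount L (suc (suc (suc d))) +_) (sumTo-uncons d (fillWeight (blockCount L) (suc (suc d))))

pascal : ∀ n k → suc n C suc k ≡ n C k + n C suc k
pascal n k = sym (nCk+nC[k+1]≡[n+1]C[k+1] n k)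

central-binomial-sym : ∀ L → suc (L + L) C L ≡ suc (L + L) C suc L
central-binomial-sym L = trans (nCk≡nC[n∸k] (≤-trans (m≤m+n L L) (n≤1+n _))) (cong (suc (L + L) C_) (m+n∸n≡m (suc L) L))

ballotX : ℕ → ℕ → ℕ
ballotX L h = suc (L + L + h) C suc (suc (L + h))

ballotY : ℕ → ℕ → ℕ
ballotY L h = suc (L + L + h) C suc (L + h)

Ballot : ℕ → ℕ → Set
Ballot L h = blockCount L (suc h) + ballotX L h ≡ ballotY L h

-- The arithmetic shuffles below only line up the binomial arguments of the two
-- Pascal expansions; the content is `pascal` and `blockCount-step`.
ballot-step : ∀ L h → Ballot L (suc (suc h)) → Ballot (suc L) h → Ballot (suc L) (suc h)
ballot-step L h IH₁ IH₂ =
  subst₂ (λ u v → blockCount (suc L) (suc (suc h)) + u ≡ v) (sym xe) (sym ye) (begin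
    blockCount (suc L) (suc (suc h)) + suc N C K4
      ≡⟨ cong (blockCount (suc L) (suc (suc h)) +_) (pascal N K3) ⟩
    blockCount (suc L) (suc (suc h)) + (N C K3 + N C K4)
      ≡⟨ cong (_+ (N C K3 + N C K4)) (blockCount-step L h) ⟩
    (B₁ + B₂) + (N C K3 + N C K4)
      ≡⟨ shuffle B₁ B₂ (N C K3) (N C K4) ⟩
    (B₂ + (B₁ + N C K4)) + N C K3
      ≡⟨ cong (λ t → (B₂ + t) + N C K3) ih₁ ⟩
    (B₂ + N C K3) + N C K3
      ≡⟨ cong (_+ N C K3) ih₂ ⟩
    N C K2 + N C K3
      ≡⟨ pascal N K2 ⟨
    suc N C K3 ∎)
  where
  N K2 K3 K4 B₁ B₂ : ℕ
  N = suc (suc (suc (L + L + h)))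
  K2 = suc (suc (L + h))
  K3 = suc K2
  K4 = suc K3
  B₁ = blockCount L (suc (suc (suc h)))
  B₂ = blockCount (suc L) (suc h)
  shuffle : ∀ a b c d → (a + b) + (c + d) ≡ (b + (a + d)) + c
  shuffle = solve-∀
  eN₁ : ∀ L h → suc (suc L + suc L + suc h) ≡ suc (suc (suc (suc (L + L + h))))
  eN₁ = solve-∀
  eN₂ : ∀ L h → suc (L + L + suc (suc h)) ≡ suc (suc (suc (L + L + h)))
  eN₂ = solve-∀
  eN₃ : ∀ L h → suc (suc L + suc L + h) ≡ suc (suc (suc (L + L + h)))
  eN₃ = solve-∀
  eK₁ : ∀ L h → suc (suc L + suc h) ≡ suc (suc (suc (L + h)))
  eK₁ = solve-∀
  eK₂ : ∀ L h → suc (L + suc (suc h)) ≡ suc (suc (suc (L + h)))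
  eK₂ = solve-∀
  xe : ballotX (suc L) (suc h) ≡ suc N C K4
  xe = cong₂ _C_ (eN₁ L h) (cong suc (eK₁ L h))
  ye : ballotY (suc L) (suc h) ≡ suc N C K3
  ye = cong₂ _C_ (eN₁ L h) (eK₁ L h)
  ih₁ : B₁ + N C K4 ≡ N C K3
  ih₁ = subst₂ (λ u v → B₁ + u ≡ v) (cong₂ _C_ (eN₂ L h) (cong suc (eK₂ L h))) (cong₂ _C_ (eN₂ L h) (eK₂ L h)) IH₁
  ih₂ : B₂ + N C K3 ≡ N C K2
  ih₂ = subst₂ (λ u v → B₂ + u ≡ v) (cong (_C K3) (eN₃ L h)) (cong (_C K2) (eN₃ L h)) IH₂

ballot-zero : ∀ L → Ballot L 0 → blockCount L 1 + suc (L + L) C suc (suc L) ≡ suc (L + L) C suc L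
ballot-zero L IH = subst₂ (λ u v → blockCount L 1 + u ≡ v) (cong₂ _C_ eN (cong suc eK)) (cong₂ _C_ eN eK) IH
  where
  eN : suc (L + L + 0) ≡ suc (L + L)
  eN = cong suc (+-identityʳ (L + L))
  eK : suc (L + 0) ≡ suc L
  eK = cong suc (+-identityʳ L)

ballot-step-zero : ∀ L → Ballot L 1 → Ballot L 0 → Ballot (suc L) 0
ballot-step-zero L IH₁ IH₀ =
  subst₂ (λ u v → blockCount (suc L) 1 + u ≡ v) (sym (cong₂ _C_ eN₁ (cong suc eK₁))) (sym (cong₂ _C_ eN₁ eK₁)) (begin
    blockCount (suc L) 1 + suc N C suc (suc (suc L))
      ≡⟨ cong (blockCount (suc L) 1 +_) (pascal N (suc (suc L))) ⟩
    blockCount L 2 + blockCount L 1 + (N C suc (suc L) + N C suc (suc (suc L)))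
      ≡⟨ shuffle (blockCount L 2) (blockCount L 1) (N C suc (suc L)) (N C suc (suc (suc L))) ⟩
    (blockCount L 2 + N C suc (suc (suc L))) + (blockCount L 1 + N C suc (suc L))
      ≡⟨ cong₂ _+_ ih₁ (cong (blockCount L 1 +_) (pascal M (suc L))) ⟩
    N C suc (suc L) + (blockCount L 1 + (y₀ + x₀))
      ≡⟨ cong (λ t → N C suc (suc L) + t) (trans (cong (blockCount L 1 +_) (+-comm y₀ x₀)) (sym (+-assoc (blockCount L 1) x₀ y₀))) ⟩
    N C suc (suc L) + ((blockCount L 1 + x₀) + y₀)
      ≡⟨ cong (λ t → N C suc (suc L) + (t + y₀)) (ballot-zero L IH₀) ⟩
    N C suc (suc L) + (y₀ + y₀)
      ≡⟨ cong (N C suc (suc L) +_) (trans (cong (_+ y₀) (sym (central-binomial-sym L))) (sym (pascal M L))) ⟩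
    N C suc (suc L) + N C suc L
      ≡⟨ trans (+-comm (N C suc (suc L)) (N C suc L)) (sym (pascal N (suc L))) ⟩
    suc N C suc (suc L) ∎)
  where
  N M x₀ y₀ : ℕ
  N = suc (suc (L + L))
  M = suc (L + L)
  x₀ = M C suc (suc L)
  y₀ = M C suc L
  shuffle : ∀ a b c d → a + b + (c + d) ≡ (a + d) + (b + c)
  shuffle = solve-∀
  eN₁ : suc (suc L + suc L + 0) ≡ suc (suc (suc (L + L)))
  eN₁ = cong suc (trans (+-identityʳ (suc L + suc L)) (cong suc (+-suc L L)))
  eK₁ : suc (suc L + 0) ≡ suc (suc L)
  eK₁ = cong suc (+-identityʳ (suc L))
  ih₁ : blockCount L 2 + N C suc (suc (suc L)) ≡ N C suc (suc L)
  ih₁ = subst₂ (λ u v → blockCount L 2 + u ≡ v) (cong₂ _C_ eN (cong suc eK)) (cong₂ _C_ eN eK) IH₁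
    where
    eN : suc (L + L + 1) ≡ suc (suc (L + L))
    eN = cong suc (+-comm (L + L) 1)
    eK : suc (L + 1) ≡ suc (suc L)
    eK = cong suc (+-comm L 1)

blockCount-ballot : ∀ L h → Ballot L h
blockCount-ballot zero h = trans (cong (1 +_) (k>n⇒nCk≡0 {suc h} {suc (suc h)} ≤-refl)) (sym (nCn≡1 (suc h)))
blockCount-ballot (suc L) zero = ballot-step-zero L (blockCount-ballot L 1) (blockCount-ballot L 0)
blockCount-ballot (suc L) (suc h) = ballot-step L h (blockCount-ballot L (suc (suc h))) (blockCount-ballot (suc L) h)

absorption : ∀ n r → suc r * (n C suc r) + r * (n C r) ≡ n * (n C r)
absorption zero zero = refl
absorption zero (suc r) = cong₂ _+_ (*-zeroʳ (suc (suc r))) (*-zeroʳ (suc r))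
absorption (suc n) zero = trans (+-identityʳ _) (trans (*-identityˡ _) (trans (nC1≡n (suc n)) (sym (*-identityʳ (suc n)))))
absorption (suc n) (suc s) = begin
  suc (suc s) * (suc n C suc (suc s)) + suc s * (suc n C suc s)
    ≡⟨ cong₂ (λ u v → suc (suc s) * u + suc s * v) (pascal n (suc s)) (pascal n s) ⟩
  suc (suc s) * (B + E) + suc s * (A + B)
    ≡⟨ shuffle s A B E ⟩
  (suc (suc s) * E + suc s * B) + (suc s * B + s * A) + (A + B)
    ≡⟨ cong₂ (λ u v → u + v + (A + B)) (absorption n (suc s)) (absorption n s) ⟩
  n * B + n * A + (A + B)
    ≡⟨ collect n A B ⟩
  suc n * (A + B)
    ≡⟨ cong (suc n *_) (pascal n s) ⟨
  suc n * (suc n C suc s) ∎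
  where
  A B E : ℕ
  A = n C s
  B = n C suc s
  E = n C suc (suc s)
  shuffle : ∀ s A B E → suc (suc s) * (B + E) + suc s * (A + B) ≡ (suc (suc s) * E + suc s * B) + (suc s * B + s * A) + (A + B)
  shuffle = solve-∀
  collect : ∀ n A B → n * B + n * A + (A + B) ≡ suc n * (A + B)
  collect = solve-∀

-- The ballot formula at h = 0 and absorption give C(2L+2, L+1) = (L+2) · blockCount L 1.
catalan≡blockCount : ∀ L → catalan (suc L) ≡ blockCount L 1
catalan≡blockCount L = trans (cong (_/ suc (suc L)) central) (m*n/n≡m D (suc (suc L)))
  where
  M x₀ y₀ D : ℕ
  M = suc (L + L)
  x₀ = M C suc (suc L)
  y₀ = M C suc L
  D = blockCount L 1
  shuffle : ∀ D x₀ y₀ L → D * suc (suc L) + (suc (suc L) * x₀ + suc L * y₀) ≡ suc (suc L) * (D + x₀) + suc L * y₀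
  shuffle = solve-∀
  collect : ∀ y₀ L → suc (suc L) * y₀ + suc L * y₀ ≡ (y₀ + y₀) + suc (L + L) * y₀
  collect = solve-∀
  cancelled : D * suc (suc L) + M * y₀ ≡ (y₀ + y₀) + M * y₀
  cancelled = begin
    D * suc (suc L) + M * y₀                            ≡⟨ cong (D * suc (suc L) +_) (absorption M (suc L)) ⟨
    D * suc (suc L) + (suc (suc L) * x₀ + suc L * y₀)   ≡⟨ shuffle D x₀ y₀ L ⟩
    suc (suc L) * (D + x₀) + suc L * y₀                 ≡⟨ cong (λ t → suc (suc L) * t + suc L * y₀) (ballot-zero L (blockCount-ballot L 0)) ⟩
    suc (suc L) * y₀ + suc L * y₀                       ≡⟨ collect y₀ L ⟩
    (y₀ + y₀) + M * y₀                                  ∎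
  central : (suc L + suc L) C suc L ≡ D * suc (suc L)
  central = begin
    (suc L + suc L) C suc L   ≡⟨ cong (_C suc L) (cong suc (+-suc L L)) ⟩
    suc M C suc L             ≡⟨ pascal M L ⟩
    M C L + y₀                ≡⟨ cong (_+ y₀) (central-binomial-sym L) ⟩
    y₀ + y₀                   ≡⟨ +-cancelʳ-≡ (M * y₀) _ _ cancelled ⟨
    D * suc (suc L)           ∎

fillWeight-zero : ∀ f d c → d ≤ c → fillWeight f d c ≡ 0
fillWeight-zero f zero c le = refl
fillWeight-zero f (suc d) (suc c) (s≤s le) = fillWeight-zero f d c le

count-stuck-fill : ∀ k₀ L₁ M a → L₁ < k₀ → (a <ᵇ k₀) ≡ true →
  (∀ d₁ → 1 ≤ d₁ → d₁ ≤ suc (suc a) → count (λ b → stuck k₀ (trace (suc k₀) (holes (suc a) d₁) b)) (box L₁ M) ≡ blockCount L₁ d₁) →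
  ∀ d c → d ≤ suc a → count (λ b → stuck k₀ (if reachable (suc k₀) (fill a d c) then trace (suc k₀) (fill a d c) b else nothing)) (box L₁ M) ≡ fillWeight (blockCount L₁) d c
count-stuck-fill k₀ L₁ M a L<k reach IH zero c _ = count-box-none L₁ M _ (λ b e → stuck-surplus k₀ c b (≤-trans (≤-reflexive e) (<⇒≤ L<k)))
count-stuck-fill k₀ L₁ M a L<k reach IH (suc d) zero le =
  trans (count-cong (box L₁ M) (λ b → cong (λ t → stuck k₀ (if t then trace (suc k₀) (holes (suc a) (suc d)) b else nothing)) reach))
        (IH (suc d) (s≤s z≤n) (≤-trans le (n≤1+n (suc a))))
count-stuck-fill k₀ L₁ M a L<k reach IH (suc d) (suc c) le = count-stuck-fill k₀ L₁ M a L<k reach IH d c (≤-trans (n≤1+n d) le)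

count-stuck-holes : ∀ k₀ L a d M → a + L ≡ k₀ → 1 ≤ d → d ≤ suc a → suc k₀ ≤ M →
  count (λ b → stuck k₀ (trace (suc k₀) (holes a d) b)) (box L M) ≡ blockCount L d
count-stuck-holes k₀ zero a d M a+L≡k 1≤d d≤1+a k<M rewrite sym (trans (sym (+-identityʳ a)) a+L≡k) | n<ᵇn≡false a = refl
count-stuck-holes k₀ (suc L₁) a d zero a+L≡k 1≤d d≤1+a ()
count-stuck-holes k₀ (suc L₁) a d (suc M₁) a+L≡k 1≤d d≤1+a k<M =
  trans (count-box-uncons L₁ (suc M₁) _)
  (trans (sumTo-uncons M₁ _)
  (cong₂ _+_
    (trans (count-cong (box L₁ (suc M₁)) (λ b → cong (λ t → stuck k₀ (if t then trace (suc k₀) (holes (suc a) (suc d)) b else nothing)) reach))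
      (count-stuck-holes k₀ L₁ (suc a) (suc d) (suc M₁) (trans (sym (+-suc a L₁)) a+L≡k) (s≤s z≤n) (s≤s d≤1+a) k<M))
    (trans (sumTo-cong M₁ (λ c _ → count-stuck-fill k₀ L₁ (suc M₁) a L<k reach IH d c d≤1+a))
      (sumTo-padZeros (pred d) M₁ _ d-1≤M (λ c lt → fillWeight-zero (blockCount L₁) d c (≤-trans (≤-reflexive (sym (suc-pred d {{d≢0}}))) lt))))))
  where
  a<k : a < k₀
  a<k = ≤-trans (s≤s (m≤m+n a L₁)) (≤-reflexive (trans (sym (+-suc a L₁)) a+L≡k))
  reach : (a <ᵇ k₀) ≡ true
  reach = <⇒<ᵇ≡true {a} {k₀} a<k
  L<k : L₁ < k₀
  L<k = ≤-trans (s≤s (m≤n+m L₁ a)) (≤-reflexive (trans (sym (+-suc a L₁)) a+L≡k))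
  IH : ∀ d₁ → 1 ≤ d₁ → d₁ ≤ suc (suc a) → count (λ b → stuck k₀ (trace (suc k₀) (holes (suc a) d₁) b)) (box L₁ (suc M₁)) ≡ blockCount L₁ d₁
  IH d₁ h h2 = count-stuck-holes k₀ L₁ (suc a) d₁ (suc M₁) (trans (sym (+-suc a L₁)) a+L≡k) h h2 k<M
  d≢0 : NonZero d
  d≢0 = >-nonZero 1≤d
  d-1≤M : pred d ≤ M₁
  d-1≤M = ≤-trans (pred-mono-≤ d≤1+a) (≤-trans (<⇒≤ a<k) (≤-pred k<M))

blocks≡catalan : ∀ k₀ M → suc k₀ ≤ M → blocks k₀ M ≡ catalan (suc k₀)
blocks≡catalan k₀ zero ()
blocks≡catalan k₀ (suc M₁) k<M =
  trans (count-box-uncons k₀ (suc M₁) _)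
  (trans (sumTo-uncons M₁ _)
  (trans (cong₂ _+_ (count-stuck-holes k₀ k₀ 0 1 (suc M₁) refl (s≤s z≤n) (s≤s z≤n) k<M)
                    (sumTo-zero M₁ _ (λ c _ → count-box-none k₀ (suc M₁) _ (λ b e → stuck-surplus k₀ c b (≤-reflexive e)))))
  (trans (+-identityʳ _) (sym (catalan≡blockCount k₀)))))

-- I and U count accepted content vectors

count-ascending : ∀ n m P → count (λ α → ascending α ∧ P α) (prefs n m) ≡ countAsc n 1 m P
count-ascending n zero P = refl
count-ascending n (suc m) P =
  trans (count-concatMap _ (λ a → map (a ∷_) (prefs n m)) (map suc (upTo n)))
  (trans (sumBy-map _ suc (upTo n))
  (trans (sumBy-applyUpTo _ (λ i → i) n)
  (trans (sumBelow-cong n (λ i → trans (count-map _ (suc i ∷_) (prefs n m))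
      (trans (count-cong (prefs n m) (λ β → cong (_∧ P (suc i ∷ β)) (ascending-∷ (suc i) β))) (sym (+-identityʳ _)))))
  (sym (countAsc-suc n 1 m P)))))

emptyLot≡lot : ∀ n → emptyLot n ≡ lot [] 0 n
emptyLot≡lot zero = refl
emptyLot≡lot (suc n) = cong (false ∷_) (emptyLot≡lot n)

isNaplesPF-expand : ∀ n k cs → length cs ≡ n → sum cs ≡ n → isNaplesPF n k (expand 1 cs) ≡ accepts k start cs
isNaplesPF-expand n k cs ln sm = trans (cong (λ s → isJust (runCars k s (expand 1 cs))) (emptyLot≡lot n)) (simulate k (surplus 0) [] 0 n cs (refl , refl) refl ln (trans sm (sym (+-identityʳ n))))

accepts-unbalanced : ∀ k n cs → length cs ≡ n → (sum cs ≡ᵇ n) ≡ false → accepts k start cs ≡ false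
accepts-unbalanced k n cs len unbalanced with accepts k start cs in acc
... | false = refl
... | true = ⊥-elim (subst T unbalanced (≡⇒≡ᵇ (sum cs) n (trans (accepts-balance k start cs acc) len)))

naples≡accepts : ∀ n k cs → length cs ≡ n → ((sum cs ≡ᵇ n) ∧ isNaplesPF n k (expand 1 cs)) ≡ accepts k start cs
naples≡accepts n k cs len with sum cs ≡ᵇ n in balanced
... | true = isNaplesPF-expand n k cs len (≡ᵇ⇒≡ (sum cs) n (Equivalence.from T-≡ balanced))
... | false = sym (accepts-unbalanced k n cs len balanced)

I≡count-accepts : ∀ n k → I n k ≡ count (accepts k start) (box n n)
I≡count-accepts n k = trans (count-ascending n n (isNaplesPF n k)) (trans (countAsc≡count-box n n 0 refl n n (isNaplesPF n k) ≤-refl) (count-box-cong n n _ _ (λ cs ln → naples≡accepts n k cs ln)))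

firstIsOne-expand-later : ∀ j cs → firstIsOne (expand (suc (suc j)) cs) ≡ false
firstIsOne-expand-later j [] = refl
firstIsOne-expand-later j (zero ∷ cs) = firstIsOne-expand-later (suc j) cs
firstIsOne-expand-later j (suc c ∷ cs) = refl

firstIsOne-expand : ∀ cs → firstIsOne (expand 1 cs) ≡ headPositive cs
firstIsOne-expand [] = refl
firstIsOne-expand (zero ∷ cs) = firstIsOne-expand-later 0 cs
firstIsOne-expand (suc c ∷ cs) = refl

naples-first≡accepts : ∀ n k cs → length cs ≡ n → ((sum cs ≡ᵇ n) ∧ (isNaplesPF n k (expand 1 cs) ∧ firstIsOne (expand 1 cs))) ≡ (headPositive cs ∧ accepts k start cs)
naples-first≡accepts n k cs len rewrite firstIsOne-expand cs with sum cs ≡ᵇ n in balanced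
... | true rewrite isNaplesPF-expand n k cs len (≡ᵇ⇒≡ (sum cs) n (Equivalence.from T-≡ balanced)) = ∧-comm (accepts k start cs) (headPositive cs)
... | false rewrite accepts-unbalanced k n cs len balanced = sym (∧-zeroʳ (headPositive cs))

U≡countU : ∀ n k → U n k ≡ countU k n n
U≡countU n k = trans (count-ascending n n (λ α → isNaplesPF n k α ∧ firstIsOne α)) (trans (countAsc≡count-box n n 0 refl n n _ ≤-refl) (count-box-cong n n _ _ (λ cs ln → naples-first≡accepts n k cs ln)))

accepts-bounded : ∀ k i xs c ys → length xs + suc (length ys) ≡ i → i < c → accepts k start (xs ++ c ∷ ys) ≡ false
accepts-bounded k i xs c ys len c>i with accepts k start (xs ++ c ∷ ys) in acc
... | false = refl
... | true = ⊥-elim (<⇒≱ c>i (≤-trans (∈-sum xs c ys) (≤-reflexive sum≡i)))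
  where
  sum≡i : sum (xs ++ c ∷ ys) ≡ i
  sum≡i = trans (accepts-balance k start (xs ++ c ∷ ys) acc) (trans (length-++ xs) len)

I≡count-accepts-box : ∀ k i M → i ≤ M → count (accepts k start) (box i M) ≡ I i k
I≡count-accepts-box k i M i≤M =
  trans (count-box-bound i M i (accepts k start) i≤M (accepts-bounded k i)) (sym (I≡count-accepts i k))

U≡countU-box : ∀ k i M → i ≤ M → countU k i M ≡ U i k
U≡countU-box k i M i≤M = trans (count-box-bound i M i _ i≤M bounded) (sym (U≡countU i k))
  where
  bounded : ∀ xs c ys → length xs + suc (length ys) ≡ i → i < c → (headPositive (xs ++ c ∷ ys) ∧ accepts k start (xs ++ c ∷ ys)) ≡ false
  bounded xs c ys len c>i = trans (cong (headPositive (xs ++ c ∷ ys) ∧_) (accepts-bounded k i xs c ys len c>i)) (∧-zeroʳ _)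

block-suffix : ∀ k₀ n m → suc k₀ ≤ n → m ≤ n → blocks k₀ n * countU (suc k₀) m n ≡ catalan (suc k₀) * U m (suc k₀)
block-suffix k₀ n m k<n m≤n = cong₂ _*_ (blocks≡catalan k₀ n k<n) (U≡countU-box (suc k₀) m n m≤n)

I-recurrence : ∀ k₀ n → suc k₀ ≤ n →
  I n (suc k₀) ≡ I n k₀ + catalan (suc k₀) * sumTo (n ∸ suc k₀) (λ i → I i k₀ * U (n ∸ suc k₀ ∸ i) (suc k₀))
I-recurrence k₀ n k<n = begin
  I n (suc k₀)
    ≡⟨ trans (sym (I≡count-accepts-box (suc k₀) n n ≤-refl)) (count-accepts-suc k₀ n n k<n ≤-refl) ⟩
  count (accepts k₀ start) (box n n) + sumTo m (λ i → count (accepts k₀ start) (box i n) * (blocks k₀ n * countU (suc k₀) (m ∸ i) n))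
    ≡⟨ cong₂ _+_ (I≡count-accepts-box k₀ n n ≤-refl) (sumTo-cong m summand) ⟩
  I n k₀ + sumTo m (λ i → I i k₀ * (catalan (suc k₀) * U (m ∸ i) (suc k₀)))
    ≡⟨ cong (I n k₀ +_) (trans (sumTo-cong m (λ i _ → *-left-comm (I i k₀) (catalan (suc k₀)) (U (m ∸ i) (suc k₀)))) (sumTo-*ˡ m (catalan (suc k₀)) _)) ⟩
  I n k₀ + catalan (suc k₀) * sumTo m (λ i → I i k₀ * U (m ∸ i) (suc k₀)) ∎
  where
  m = n ∸ suc k₀
  summand : ∀ i → i ≤ m → count (accepts k₀ start) (box i n) * (blocks k₀ n * countU (suc k₀) (m ∸ i) n) ≡ I i k₀ * (catalan (suc k₀) * U (m ∸ i) (suc k₀))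
  summand i i≤m = cong₂ _*_ (I≡count-accepts-box k₀ i n (≤-trans i≤m (m∸n≤m n (suc k₀)))) (block-suffix k₀ n (m ∸ i) k<n (≤-trans (m∸n≤m m i) (m∸n≤m n (suc k₀))))

U-recurrence : ∀ k₀ n → suc k₀ ≤ n →
  U n (suc k₀) ≡ U n k₀ + sumTo (n ∸ suc k₀) (λ i → U i k₀ * catalan (suc k₀) * U (n ∸ suc k₀ ∸ i) (suc k₀))
U-recurrence k₀ n k<n = begin
  U n (suc k₀)
    ≡⟨ trans (sym (U≡countU-box (suc k₀) n n ≤-refl)) (countU-suc k₀ n n k<n ≤-refl) ⟩
  countU k₀ n n + sumTo m (λ i → countU k₀ i n * (blocks k₀ n * countU (suc k₀) (m ∸ i) n))
    ≡⟨ cong₂ _+_ (U≡countU-box k₀ n n ≤-refl) (sumTo-cong m summand) ⟩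
  U n k₀ + sumTo m (λ i → U i k₀ * catalan (suc k₀) * U (m ∸ i) (suc k₀)) ∎
  where
  m = n ∸ suc k₀
  summand : ∀ i → i ≤ m → countU k₀ i n * (blocks k₀ n * countU (suc k₀) (m ∸ i) n) ≡ U i k₀ * catalan (suc k₀) * U (m ∸ i) (suc k₀)
  summand i i≤m = trans (cong₂ _*_ (U≡countU-box k₀ i n (≤-trans i≤m (m∸n≤m n (suc k₀)))) (block-suffix k₀ n (m ∸ i) k<n (≤-trans (m∸n≤m m i) (m∸n≤m n (suc k₀)))))
                        (sym (*-assoc (U i k₀) (catalan (suc k₀)) (U (m ∸ i) (suc k₀))))

theorem5p2 : (n k : ℕ) → 1 ≤ k → k ≤ n ∸ 1 →
    (I n k ≡ I n (k ∸ 1) + catalan k * sumTo (n ∸ k) (λ i → I i (k ∸ 1) * U (n ∸ k ∸ i) k))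
    × (U n k ≡ U n (k ∸ 1) + sumTo (n ∸ k) (λ i → U i (k ∸ 1) * catalan k * U (n ∸ k ∸ i) k))
theorem5p2 n (suc k₀) (s≤s z≤n) k≤n-1 = I-recurrence k₀ n k≤n , U-recurrence k₀ n k≤n
  where
  k≤n : suc k₀ ≤ n
  k≤n = ≤-trans k≤n-1 (m∸n≤m n 1)
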